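{- Let $p$ be an odd prime, let $p'=\frac{p-1}{2}$, and let $g$ be a positive integer with $2g+3\ge p$ and $\gcd(g+1,p')=1$. Let $j$ be the least nonnegative residue of $2g+2$ modulo $p-1$ and let $k=\frac{2g+2-j}{p-1}$. Then the polynomial $x^{2g+2}-x^{2g+3-p}+1$ has repeated roots over $\overline{\mathbb{F}_p}$ if and only if $g\equiv \frac{p^2-5}{4}+\frac{jp}{2} \pmod{pp'}$ and one of the following holds: (i) $p\equiv 3 \pmod 8$ and $j\equiv 2k \pmod 4$; (ii) $p\equiv 7\pmod 8$ and $j\equiv 2k+2\pmod 4$; (iii) $p\equiv 5\pmod 8$ and $j\equiv 2\pmod 4$. -}

module Defs where

open import Level using (0ℓ)
open import Algebra.Bundles using (CommutativeRing)
open import Data.Nat as ℕ using (ℕ; zero; suc)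
open import Data.List using (List; []; _∷_; map)
open import Data.Product using (Σ; ∃; _×_; _,_)
open import Relation.Nullary using (¬_)

record Field : Set₁ where
  field
    commRing : CommutativeRing 0ℓ 0ℓ
  open CommutativeRing commRing public
  field
    1≉0     : ¬ (1# ≈ 0#)
    inverse : ∀ x → ¬ (x ≈ 0#) → Σ Carrier λ y → (x * y) ≈ 1#

module _ (K : Field) where
  open Field K

  natK : ℕ → Carrier
  natK zero    = 0#
  natK (suc n) = 1# + natK n

  HasChar : ℕ → Set
  HasChar p = natK p ≈ 0#

  -- Polynomials over K as coefficient lists, constant coefficient first.
  Poly : Set
  Poly = List Carrier

  coeff : Poly → ℕ → Carrier
  coeff []       _       = 0#
  coeff (c ∷ cs) zero    = c
  coeff (c ∷ cs) (suc n) = coeff cs n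

  addP : Poly → Poly → Poly
  addP []       qs       = qs
  addP (p ∷ ps) []       = p ∷ ps
  addP (p ∷ ps) (q ∷ qs) = (p + q) ∷ addP ps qs

  mulLin : Carrier → Poly → Poly
  mulLin a q = addP (0# ∷ q) (map (λ c → - (a * c)) q)

  δ : ℕ → ℕ → Carrier
  δ zero    zero    = 1#
  δ zero    (suc _) = 0#
  δ (suc _) zero    = 0#
  δ (suc m) (suc n) = δ m n

  fCoeff : ℕ → ℕ → ℕ → Carrier
  fCoeff p g n = (δ n (2 ℕ.* g ℕ.+ 2) + - δ n (2 ℕ.* g ℕ.+ 3 ℕ.∸ p)) + δ n 0

  RepeatedRootAt : ℕ → ℕ → Carrier → Set
  RepeatedRootAt p g a =
    Σ Poly λ q → ∀ n → coeff (mulLin a (mulLin a q)) n ≈ fCoeff p g n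

-- x^(2g+2) - x^(2g+3-p) + 1 has a repeated root over the algebraic closure
-- of F_p: there is a field of characteristic p containing a repeated root.
HasRepeatedRoot : ℕ → ℕ → Set₁
HasRepeatedRoot p g =
  Σ Field λ K → HasChar K p × Σ (Field.Carrier K) λ a → RepeatedRootAt K p g a

module Submission where

-- Let n = 2g+2 and m = 2g+3-p = n-(p-1), so that m = n+1 in characteristic p.  A double root a of
-- f = xⁿ - xᵐ + 1 satisfies f(a) = 0 and a·f′(a) = n aⁿ - m aᵐ = 0; these give n·c = m for c = a^(p-1),
-- so c is a quotient of elements of 𝔽ₚ, and aⁿ = (a²)^(g+1) = -m lies in 𝔽ₚ too.  As gcd(g+1, p′) = 1
-- this forces c² = 1, and c ≠ 1 leaves c = -1, that is 1 + 2n ≡ 0 (mod p), the congruence on g.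
-- With j = 2j′ and aⁿ = (-1)ᵏ a^(2j′) we get 2(-1)ᵏ a^(2j′) = -1; its p′-th power together with
-- Gauss's lemma 2^p′ = (-1)^⌈p′/2⌉ is a parity condition on ⌈p′/2⌉ + kp′ + j′ + p′, which is (i)-(iii)
-- read modulo 8.  Conversely these conditions yield β ∈ 𝔽ₚ with β^p′ = -1 and 2(-1)ᵏβ^j′ = -1; such β
-- is not a square, and √β ∈ 𝔽ₚ(√β) is a double root.

open import Defs
open import Data.Nat as ℕ using (ℕ; zero; suc)
open import Data.Nat.Primality using (Prime)
open import Relation.Binary.PropositionalEquality as ≡ using (_≡_)
open import Relation.Nullary using (¬_)

module Combinatorics where

  open import Data.Nat
  open import Data.Nat.Properties
  open import Data.Nat.Combinatorics using (_C_; nCk≡n!/k![n-k]!; k![n∸k]!∣n!)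
  open import Data.Nat.DivMod using (m*[n/m]≡n)
  open import Data.Nat.Divisibility using (_∣_; _∤_; ∣⇒≤; n∣m*n)
  open import Data.Nat.Primality using (Prime; euclidsLemma; prime⇒nonTrivial; prime⇒irreducible)
  open import Data.Nat.Coprimality using (Coprime)
  open import Data.Nat.Tactic.RingSolver using (solve-∀)
  open import Data.Sum as Sum using (_⊎_; inj₁; inj₂; [_,_]′)
  open import Data.Product using (_,_)
  open import Data.Empty using (⊥-elim)
  open import Relation.Binary.PropositionalEquality
  open ≡-Reasoning

  prime∤! : ∀ {p} n → Prime p → n < p → p ∤ n !
  prime∤! {p} zero p-prime _ p∣1 = <⇒≱ (nonTrivial⇒n>1 p ⦃ prime⇒nonTrivial p-prime ⦄) (∣⇒≤ p∣1)
  prime∤! (suc n) p-prime n<p p∣n! =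
    [ (λ p∣1+n → <⇒≱ n<p (∣⇒≤ p∣1+n)) , prime∤! n p-prime (<-trans (n<1+n n) n<p) ]′
      (euclidsLemma (suc n) (n !) p-prime p∣n!)

  prime∣C : ∀ {p k} → Prime p → 0 < k → k < p → p ∣ p C k
  prime∣C {p@(suc p-1)} {k} p-prime 0<k k<p = fromEuclid (euclidsLemma (k ! * (p ∸ k) !) (p C k) p-prime p∣product)
    where
    instance _ = k !* (p ∸ k) !≢0
    p∸k<p : p ∸ k < p
    p∸k<p = ∸-monoʳ-< 0<k (<⇒≤ k<p)
    p∣product : p ∣ k ! * (p ∸ k) ! * (p C k)
    p∣product = subst (p ∣_)
      (sym (trans (cong (k ! * (p ∸ k) ! *_) (nCk≡n!/k![n-k]! (<⇒≤ k<p)))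
                  (m*[n/m]≡n (k![n∸k]!∣n! (<⇒≤ k<p)))))
      (subst (p ∣_) (*-comm (p-1 !) p) (n∣m*n (p-1 !)))
    fromEuclid : p ∣ k ! * (p ∸ k) ! ⊎ p ∣ p C k → p ∣ p C k
    fromEuclid (inj₂ p∣C) = p∣C
    fromEuclid (inj₁ p∣k![p∸k]!) = ⊥-elim ([ prime∤! k p-prime k<p , prime∤! (p ∸ k) p-prime p∸k<p ]′
                                              (euclidsLemma (k !) ((p ∸ k) !) p-prime p∣k![p∸k]!))

  prime∤⇒coprime : ∀ {p n} → Prime p → p ∤ n → Coprime p n
  prime∤⇒coprime p-prime p∤n (d∣p , d∣n) with prime⇒irreducible p-prime d∣p
  ... | inj₁ d≡1 = d≡1
  ... | inj₂ refl = ⊥-elim (p∤n d∣n)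

  ∏< : ℕ → (ℕ → ℕ) → ℕ
  ∏< zero    f = 1
  ∏< (suc n) f = ∏< n f * f n

  ∏<-cong : ∀ n {f g} → (∀ i → i < n → f i ≡ g i) → ∏< n f ≡ ∏< n g
  ∏<-cong zero    f≡g = refl
  ∏<-cong (suc n) f≡g = cong₂ _*_ (∏<-cong n (λ i i<n → f≡g i (m<n⇒m<1+n i<n))) (f≡g n (n<1+n n))

  ∏<-+ : ∀ m n f → ∏< (m + n) f ≡ ∏< m f * ∏< n (λ i → f (m + i))
  ∏<-+ m zero    f = trans (cong (λ k → ∏< k f) (+-identityʳ m)) (sym (*-identityʳ _))
  ∏<-+ m (suc n) f = begin
    ∏< (m + suc n) f                            ≡⟨ cong (λ k → ∏< k f) (+-suc m n) ⟩
    ∏< (m + n) f * f (m + n)                    ≡⟨ cong (_* f (m + n)) (∏<-+ m n f) ⟩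
    ∏< m f * ∏< n (λ i → f (m + i)) * f (m + n) ≡⟨ *-assoc (∏< m f) _ _ ⟩
    ∏< m f * ∏< (suc n) (λ i → f (m + i))       ∎

  ∏<-suc : ∀ n f → ∏< (suc n) f ≡ f 0 * ∏< n (λ i → f (suc i))
  ∏<-suc n f = trans (∏<-+ 1 n f) (cong (_* ∏< n (λ i → f (suc i))) (*-identityˡ (f 0)))

  ∏<-reverse : ∀ n f → ∏< n (λ i → f (n ∸ suc i)) ≡ ∏< n f
  ∏<-reverse zero    f = refl
  ∏<-reverse (suc n) f = begin
    ∏< n (λ i → f (suc n ∸ suc i)) * f (n ∸ n) ≡⟨ cong₂ _*_ (∏<-cong n λ i i<n → cong f (+-∸-assoc 1 i<n)) (cong f (n∸n≡0 n)) ⟩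
    ∏< n (λ i → f (suc (n ∸ suc i))) * f 0     ≡⟨ cong (_* f 0) (∏<-reverse n (λ i → f (suc i))) ⟩
    ∏< n (λ i → f (suc i)) * f 0               ≡⟨ *-comm _ (f 0) ⟩
    f 0 * ∏< n (λ i → f (suc i))               ≡⟨ ∏<-suc n f ⟨
    ∏< (suc n) f                               ∎

  evens odds : ℕ → ℕ
  evens n = ∏< n (λ i → 2 * suc i)
  odds  n = ∏< n (λ i → suc (2 * i))

  evens≡2^n*n! : ∀ n → evens n ≡ 2 ^ n * n !
  evens≡2^n*n! zero    = refl
  evens≡2^n*n! (suc n) = trans (cong (_* (2 * suc n)) (evens≡2^n*n! n)) (regroup (2 ^ n) (n !) n)
    where
    regroup : ∀ a b n → a * b * (2 * suc n) ≡ 2 * a * (b + n * b)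
    regroup = solve-∀

  evens*odds≡[n+n]! : ∀ n → evens n * odds n ≡ (n + n) !
  evens*odds≡[n+n]! zero    = refl
  evens*odds≡[n+n]! (suc n) = begin
    evens n * (2 * suc n) * (odds n * suc (2 * n))        ≡⟨ regroup (evens n) (odds n) n ⟩
    suc (suc (n + n)) * (suc (n + n) * (evens n * odds n)) ≡⟨ cong (λ x → suc (suc (n + n)) * (suc (n + n) * x)) (evens*odds≡[n+n]! n) ⟩
    (suc (suc (n + n))) !                                  ≡⟨ cong _! (+-suc (suc n) n) ⟨
    (suc n + suc n) !                                      ∎
    where
    regroup : ∀ e o n → e * (2 * suc n) * (o * suc (2 * n)) ≡ suc (suc (n + n)) * (suc (n + n) * (e * o))
    regroup = solve-∀

  evens*odds≡[h+r]! : ∀ h r → r ≡ h ⊎ r ≡ suc h → evens h * odds r ≡ (h + r) !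
  evens*odds≡[h+r]! h .h       (inj₁ refl) = evens*odds≡[n+n]! h
  evens*odds≡[h+r]! h .(suc h) (inj₂ refl) = begin
    evens h * (odds h * suc (2 * h)) ≡⟨ *-assoc (evens h) _ _ ⟨
    evens h * odds h * suc (2 * h)   ≡⟨ cong (_* suc (2 * h)) (evens*odds≡[n+n]! h) ⟩
    (h + h) ! * suc (2 * h)          ≡⟨ regroup h ((h + h) !) ⟩
    suc (h + h) * (h + h) !          ≡⟨ cong _! (+-suc h h) ⟨
    (h + suc h) !                    ∎
    where
    regroup : ∀ h x → x * suc (2 * h) ≡ suc (h + h) * x
    regroup = solve-∀

  ⌈n/2⌉≡⌊n/2⌋⊎1+⌊n/2⌋ : ∀ n → ⌈ n /2⌉ ≡ ⌊ n /2⌋ ⊎ ⌈ n /2⌉ ≡ suc ⌊ n /2⌋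
  ⌈n/2⌉≡⌊n/2⌋⊎1+⌊n/2⌋ zero          = inj₁ refl
  ⌈n/2⌉≡⌊n/2⌋⊎1+⌊n/2⌋ (suc zero)    = inj₂ refl
  ⌈n/2⌉≡⌊n/2⌋⊎1+⌊n/2⌋ (suc (suc n)) = Sum.map (cong suc) (cong suc) (⌈n/2⌉≡⌊n/2⌋⊎1+⌊n/2⌋ n)

module FieldTheory (K : Field) where

  import Data.Nat.Properties as ℕ
  import Data.Nat.DivMod as ℕ
  open import Data.Nat.Coprimality using (Coprime; coprime-Bézout)
  open import Data.Nat.GCD using (module Bézout)
  open import Data.Integer as ℤ using (ℤ; +_; -[1+_])
  import Data.Integer.Properties as ℤ
  open import Data.Sign as Sign using (Sign)
  open import Data.Maybe using (Maybe; just; nothing)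
  open import Data.Product using (proj₁; proj₂)
  open import Data.Empty using (⊥; ⊥-elim)
  open import Function.Base using (_⟨_⟩_)
  open import Relation.Nullary using (yes; no)
  import Algebra.Solver.Ring.AlmostCommutativeRing as ACR
  import Algebra.Solver.Ring as RingSolver
  open Combinatorics using (∏<)

  open Field K public
  open import Algebra.Properties.Ring ring public
  open import Algebra.Properties.Semiring.Exp semiring public
  open import Algebra.Properties.CommutativeSemiring.Exp commutativeSemiring public using (^-distrib-*)
  open import Algebra.Properties.Semiring.Mult semiring using (_×_; ×-homo-+; ×1-homo-*)
  open import Relation.Binary.Reasoning.Setoid setoid public

  ι : ℕ → Carrier
  ι = natK K

  ι≡× : ∀ n → ι n ≡ n × 1#
  ι≡× zero    = ≡.refl
  ι≡× (suc n) = ≡.cong (λ x → 1# + x) (ι≡× n)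

  ι-+ : ∀ m n → ι (m ℕ.+ n) ≈ ι m + ι n
  ι-+ m n rewrite ι≡× (m ℕ.+ n) | ι≡× m | ι≡× n = ×-homo-+ 1# m n

  ι-* : ∀ m n → ι (m ℕ.* n) ≈ ι m * ι n
  ι-* m n rewrite ι≡× (m ℕ.* n) | ι≡× m | ι≡× n = ×1-homo-* m n

  ι-^ : ∀ m n → ι (m ℕ.^ n) ≈ ι m ^ n
  ι-^ m zero    = +-identityʳ 1#
  ι-^ m (suc n) = ι-* m (m ℕ.^ n) ⟨ trans ⟩ *-congˡ (ι-^ m n)

  ι[a*b]≈0 : ∀ a {b} → ι b ≈ 0# → ι (a ℕ.* b) ≈ 0#
  ι[a*b]≈0 a {b} ιb≈0 = ι-* a b ⟨ trans ⟩ *-congˡ ιb≈0 ⟨ trans ⟩ zeroʳ _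

  coprime⇒ι≉0 : ∀ {m n} → Coprime m n → ι m ≈ 0# → ι n ≉ 0#
  coprime⇒ι≉0 {m} {n} m⊥n ιm≈0 ιn≈0 = fromBézout (coprime-Bézout m⊥n)
    where
    contradiction : ∀ s t a b → 1 ℕ.+ s ℕ.* a ≡ t ℕ.* b → ι a ≈ 0# → ι b ≈ 0# → 1# ≈ 0#
    contradiction s t a b 1+sa≡tb ιa≈0 ιb≈0 = begin
      1#                ≈⟨ (+-congˡ (ι[a*b]≈0 s ιa≈0) ⟨ trans ⟩ +-identityʳ 1#) ⟨
      ι (1 ℕ.+ s ℕ.* a) ≡⟨ ≡.cong ι 1+sa≡tb ⟩
      ι (t ℕ.* b)       ≈⟨ ι[a*b]≈0 t ιb≈0 ⟩
      0#                ∎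
    fromBézout : Bézout.Identity 1 m n → ⊥
    fromBézout (Bézout.Identity.+- x y 1+yn≡xm) = 1≉0 (contradiction y x n m 1+yn≡xm ιn≈0 ιm≈0)
    fromBézout (Bézout.Identity.-+ x y 1+xm≡yn) = 1≉0 (contradiction x y m n 1+xm≡yn ιm≈0 ιn≈0)

  -- The ring morphism ℤ → K; through it the ring solver works with integer coefficients.
  intK : ℤ → Carrier
  intK (+ n)    = ι n
  intK -[1+ n ] = - ι (suc n)

  signed : Sign → Carrier → Carrier
  signed Sign.+ x = x
  signed Sign.- x = - x

  signed-cong : ∀ s {x y} → x ≈ y → signed s x ≈ signed s y
  signed-cong Sign.+ x≈y = x≈y
  signed-cong Sign.- x≈y = -‿cong x≈y

  signed-* : ∀ s t x y → signed (s Sign.* t) (x * y) ≈ signed s x * signed t y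
  signed-* Sign.+ Sign.+ x y = refl
  signed-* Sign.+ Sign.- x y = -‿distribʳ-* x y
  signed-* Sign.- Sign.+ x y = -‿distribˡ-* x y
  signed-* Sign.- Sign.- x y = begin
    x * y         ≈⟨ *-congʳ (-‿involutive x) ⟨
    - - x * y     ≈⟨ -‿distribˡ-* (- x) y ⟨
    - (- x * y)   ≈⟨ -‿distribʳ-* (- x) y ⟩
    - x * - y     ∎

  intK-◃ : ∀ s n → intK (s ℤ.◃ n) ≈ signed s (ι n)
  intK-◃ Sign.+ zero    = refl
  intK-◃ Sign.- zero    = sym -0#≈0#
  intK-◃ Sign.+ (suc n) = refl
  intK-◃ Sign.- (suc n) = refl

  intK≈signed : ∀ i → intK i ≈ signed (ℤ.sign i) (ι ℤ.∣ i ∣)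
  intK≈signed (+ zero)  = refl
  intK≈signed (+ suc n) = refl
  intK≈signed -[1+ n ]  = refl

  intK-* : ∀ i j → intK (i ℤ.* j) ≈ intK i * intK j
  intK-* i j = begin
    intK (i ℤ.* j)                                            ≈⟨ intK-◃ (ℤ.sign i Sign.* ℤ.sign j) (ℤ.∣ i ∣ ℕ.* ℤ.∣ j ∣) ⟩
    signed (ℤ.sign i Sign.* ℤ.sign j) (ι (ℤ.∣ i ∣ ℕ.* ℤ.∣ j ∣)) ≈⟨ signed-cong (ℤ.sign i Sign.* ℤ.sign j) (ι-* ℤ.∣ i ∣ ℤ.∣ j ∣) ⟩
    signed (ℤ.sign i Sign.* ℤ.sign j) (ι ℤ.∣ i ∣ * ι ℤ.∣ j ∣)  ≈⟨ signed-* (ℤ.sign i) (ℤ.sign j) (ι ℤ.∣ i ∣) (ι ℤ.∣ j ∣) ⟩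
    signed (ℤ.sign i) (ι ℤ.∣ i ∣) * signed (ℤ.sign j) (ι ℤ.∣ j ∣) ≈⟨ *-cong (intK≈signed i) (intK≈signed j) ⟨
    intK i * intK j                                           ∎

  intK-neg : ∀ i → intK (ℤ.- i) ≈ - intK i
  intK-neg (+ zero)  = sym -0#≈0#
  intK-neg (+ suc n) = refl
  intK-neg -[1+ n ]  = sym (-‿involutive _)

  x-y≈[1+x]-[1+y] : ∀ x y → x - y ≈ (1# + x) - (1# + y)
  x-y≈[1+x]-[1+y] x y = begin
    x - y                  ≈⟨ +-identityˡ _ ⟨
    0# + (x - y)           ≈⟨ +-congʳ (-‿inverseʳ 1#) ⟨
    (1# - 1#) + (x - y)    ≈⟨ +-assoc 1# (- 1#) (x - y) ⟩
    1# + (- 1# + (x - y))  ≈⟨ +-congˡ (+-assoc (- 1#) x (- y)) ⟨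
    1# + ((- 1# + x) - y)  ≈⟨ +-congˡ (+-congʳ (+-comm (- 1#) x)) ⟩
    1# + ((x - 1#) - y)    ≈⟨ +-congˡ (+-assoc x (- 1#) (- y)) ⟩
    1# + (x + (- 1# - y))  ≈⟨ +-congˡ (+-congˡ (sym (-‿anti-homo-+ y 1#) ⟨ trans ⟩ -‿cong (+-comm y 1#))) ⟩
    1# + (x - (1# + y))    ≈⟨ +-assoc 1# x _ ⟨
    (1# + x) - (1# + y)    ∎

  intK-⊖ : ∀ m n → intK (m ℤ.⊖ n) ≈ ι m - ι n
  intK-⊖ zero    zero    = sym (-‿inverseʳ 0#)
  intK-⊖ zero    (suc n) = sym (+-identityˡ _)
  intK-⊖ (suc m) zero    = sym (+-identityʳ _) ⟨ trans ⟩ +-congˡ (sym -0#≈0#)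
  intK-⊖ (suc m) (suc n) = begin
    intK (suc m ℤ.⊖ suc n)   ≡⟨ ≡.cong intK (ℤ.[1+m]⊖[1+n]≡m⊖n m n) ⟩
    intK (m ℤ.⊖ n)           ≈⟨ intK-⊖ m n ⟩
    ι m - ι n                ≈⟨ x-y≈[1+x]-[1+y] (ι m) (ι n) ⟩
    (1# + ι m) - (1# + ι n)  ∎

  intK-+ : ∀ i j → intK (i ℤ.+ j) ≈ intK i + intK j
  intK-+ (+ m)    (+ n)    = ι-+ m n
  intK-+ (+ m)    -[1+ n ] = intK-⊖ m (suc n)
  intK-+ -[1+ m ] (+ n)    = intK-⊖ n (suc m) ⟨ trans ⟩ +-comm _ _
  intK-+ -[1+ m ] -[1+ n ] = begin
    - (1# + ι (suc (m ℕ.+ n)))  ≈⟨ -‿cong (+-congˡ (ι-+ (suc m) n) ⟨ trans ⟩ +-comm _ _) ⟩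
    - ((ι (suc m) + ι n) + 1#)  ≈⟨ -‿cong (+-assoc _ _ _) ⟩
    - (ι (suc m) + (ι n + 1#))  ≈⟨ -‿cong (+-congˡ (+-comm _ _)) ⟩
    - (ι (suc m) + ι (suc n))   ≈⟨ -‿anti-homo-+ _ _ ⟩
    - ι (suc n) - ι (suc m)     ≈⟨ +-comm _ _ ⟩
    - ι (suc m) - ι (suc n)     ∎

  -- Agrees with intK but sends 0 and 1 to 0# and 1# on the nose, so that the solver's refl premises reduce.
  intK′ : ℤ → Carrier
  intK′ (+ 0)           = 0#
  intK′ (+ 1)           = 1#
  intK′ (+ suc (suc n)) = intK (+ suc (suc n))
  intK′ -[1+ 0 ]        = - 1#
  intK′ -[1+ suc n ]    = intK -[1+ suc n ]

  intK′≈intK : ∀ i → intK′ i ≈ intK i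
  intK′≈intK (+ 0)           = refl
  intK′≈intK (+ 1)           = sym (+-identityʳ 1#)
  intK′≈intK (+ suc (suc n)) = refl
  intK′≈intK -[1+ 0 ]        = -‿cong (sym (+-identityʳ 1#))
  intK′≈intK -[1+ suc n ]    = refl

  private
    ℤ-almostCommutativeRing = ACR.fromCommutativeRing ℤ.+-*-commutativeRing
    K-almostCommutativeRing = ACR.fromCommutativeRing commRing

    intK′-morphism : ACR._-Raw-AlmostCommutative⟶_ (ACR.AlmostCommutativeRing.rawRing ℤ-almostCommutativeRing) K-almostCommutativeRing
    intK′-morphism = record
      { ⟦_⟧    = intK′
      ; +-homo = λ i j → intK′≈intK (i ℤ.+ j) ⟨ trans ⟩ intK-+ i j ⟨ trans ⟩ +-cong (sym (intK′≈intK i)) (sym (intK′≈intK j))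
      ; *-homo = λ i j → intK′≈intK (i ℤ.* j) ⟨ trans ⟩ intK-* i j ⟨ trans ⟩ *-cong (sym (intK′≈intK i)) (sym (intK′≈intK j))
      ; -‿homo = λ i → intK′≈intK (ℤ.- i) ⟨ trans ⟩ intK-neg i ⟨ trans ⟩ -‿cong (sym (intK′≈intK i))
      ; 0-homo = refl
      ; 1-homo = refl
      }

    coefficient-equality : ∀ i j → Maybe (intK′ i ≈ intK′ j)
    coefficient-equality i j with i ℤ.≟ j
    ... | yes ≡.refl = just refl
    ... | no _       = nothing

  open RingSolver (ACR.AlmostCommutativeRing.rawRing ℤ-almostCommutativeRing) K-almostCommutativeRing
    intK′-morphism coefficient-equality public
    using (solve; _:=_; _:+_; _:*_; :-_; _:-_; con)

  ι-∏<-negate : ∀ n f g → (∀ i → i ℕ.< n → ι (f i) ≈ - ι (g i)) → ι (∏< n f) ≈ (- 1#) ^ n * ι (∏< n g)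
  ι-∏<-negate zero    f g f≈-g = sym (*-identityˡ _)
  ι-∏<-negate (suc n) f g f≈-g = begin
    ι (∏< n f ℕ.* f n)                            ≈⟨ ι-* (∏< n f) (f n) ⟩
    ι (∏< n f) * ι (f n)                          ≈⟨ *-cong (ι-∏<-negate n f g (λ i i<n → f≈-g i (ℕ.m<n⇒m<1+n i<n))) (f≈-g n (ℕ.n<1+n n)) ⟩
    ((- 1#) ^ n * ι (∏< n g)) * - ι (g n)         ≈⟨ solve 3 (λ s x y → (s :* x) :* (:- y) := ((:- con (+ 1)) :* s) :* (x :* y)) refl ((- 1#) ^ n) (ι (∏< n g)) (ι (g n)) ⟩
    (- 1# * (- 1#) ^ n) * (ι (∏< n g) * ι (g n))  ≈⟨ *-congˡ (ι-* (∏< n g) (g n)) ⟨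
    (- 1#) ^ suc n * ι (∏< n g ℕ.* g n)           ∎

  x⁻¹ : ∀ x → x ≉ 0# → Carrier
  x⁻¹ x x≉0 = proj₁ (inverse x x≉0)

  x*x⁻¹≈1 : ∀ x (x≉0 : x ≉ 0#) → x * x⁻¹ x x≉0 ≈ 1#
  x*x⁻¹≈1 x x≉0 = proj₂ (inverse x x≉0)

  *-cancelˡ : ∀ {x y z} → x ≉ 0# → x * y ≈ x * z → y ≈ z
  *-cancelˡ {x} {y} {z} x≉0 xy≈xz = begin
    y                   ≈⟨ unit y ⟩
    (x⁻¹ x x≉0 * x) * y ≈⟨ *-assoc _ x y ⟩
    x⁻¹ x x≉0 * (x * y) ≈⟨ *-congˡ xy≈xz ⟩
    x⁻¹ x x≉0 * (x * z) ≈⟨ *-assoc _ x z ⟨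
    (x⁻¹ x x≉0 * x) * z ≈⟨ unit z ⟨
    z                   ∎
    where
    unit : ∀ w → w ≈ (x⁻¹ x x≉0 * x) * w
    unit w = sym (*-congʳ (*-comm _ x ⟨ trans ⟩ x*x⁻¹≈1 x x≉0) ⟨ trans ⟩ *-identityˡ w)

  *-nonzero : ∀ {x y} → x ≉ 0# → y ≉ 0# → x * y ≉ 0#
  *-nonzero {x} x≉0 y≉0 xy≈0 = y≉0 (*-cancelˡ x≉0 (xy≈0 ⟨ trans ⟩ sym (zeroʳ x)))

  ^-nonzero : ∀ {x} n → x ≉ 0# → x ^ n ≉ 0#
  ^-nonzero zero    x≉0 = 1≉0
  ^-nonzero (suc n) x≉0 = *-nonzero x≉0 (^-nonzero n x≉0)

  1^n≈1 : ∀ n → 1# ^ n ≈ 1#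
  1^n≈1 zero    = refl
  1^n≈1 (suc n) = *-identityˡ _ ⟨ trans ⟩ 1^n≈1 n

  ^-comm : ∀ x m n → (x ^ m) ^ n ≈ (x ^ n) ^ m
  ^-comm x m n = ^-assocʳ x m n ⟨ trans ⟩ ^-congʳ x (ℕ.*-comm m n) ⟨ trans ⟩ sym (^-assocʳ x n m)

  [x*x]^n≈x^[2n] : ∀ x n → (x * x) ^ n ≈ x ^ (2 ℕ.* n)
  [x*x]^n≈x^[2n] x n = ^-congˡ n (*-congˡ (sym (*-identityʳ x))) ⟨ trans ⟩ ^-assocʳ x 2 n

  x^[2n]≈x^n*x^n : ∀ x n → x ^ (2 ℕ.* n) ≈ x ^ n * x ^ n
  x^[2n]≈x^n*x^n x n = ^-congʳ x (≡.cong (n ℕ.+_) (ℕ.+-identityʳ n)) ⟨ trans ⟩ ^-homo-* x n n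

  [-x]^n : ∀ x n → (- x) ^ n ≈ (- 1#) ^ n * x ^ n
  [-x]^n x n = ^-congˡ n (sym (-1*x≈-x x)) ⟨ trans ⟩ ^-distrib-* (- 1#) x n

  x*x≈1⇒x^[2n]≈1 : ∀ {x} n → x * x ≈ 1# → x ^ (2 ℕ.* n) ≈ 1#
  x*x≈1⇒x^[2n]≈1 {x} n x*x≈1 = sym ([x*x]^n≈x^[2n] x n) ⟨ trans ⟩ ^-congˡ n x*x≈1 ⟨ trans ⟩ 1^n≈1 n

  x*x≈1⇒x≉0 : ∀ {x} → x * x ≈ 1# → x ≉ 0#
  x*x≈1⇒x≉0 {x} x*x≈1 x≈0 = 1≉0 (sym x*x≈1 ⟨ trans ⟩ *-congʳ x≈0 ⟨ trans ⟩ zeroˡ x)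

  x*x≈1⇒x≈-1 : ∀ {x} → x * x ≈ 1# → x ≉ 1# → x ≈ - 1#
  x*x≈1⇒x≈-1 {x} x*x≈1 x≉1 = +-inverseˡ-unique x 1# (*-cancelˡ x-1≉0 (begin
    (x - 1#) * (x + 1#) ≈⟨ solve 1 (λ x → (x :- con (+ 1)) :* (x :+ con (+ 1)) := x :* x :- con (+ 1)) refl x ⟩
    x * x - 1#          ≈⟨ +-congʳ x*x≈1 ⟩
    1# - 1#             ≈⟨ -‿inverseʳ 1# ⟩
    0#                  ≈⟨ zeroʳ _ ⟨
    (x - 1#) * 0#       ∎))
    where
    x-1≉0 : x - 1# ≉ 0#
    x-1≉0 x-1≈0 = x≉1 (x∙y⁻¹≈ε⇒x≈y x 1# x-1≈0)

  x^n≈-1⇒x≉0 : ∀ {x} n → 1# ≉ - 1# → x ^ n ≈ - 1# → x ≉ 0#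
  x^n≈-1⇒x≉0     zero    1≉-1 1≈-1  _   = 1≉-1 1≈-1
  x^n≈-1⇒x≉0 {x} (suc n) _    xⁿ≈-1 x≈0 = 1≉0 (begin
    1#      ≈⟨ -‿involutive 1# ⟨
    - - 1#  ≈⟨ -‿cong (sym xⁿ≈-1 ⟨ trans ⟩ *-congʳ x≈0 ⟨ trans ⟩ zeroˡ _) ⟩
    - 0#    ≈⟨ -0#≈0# ⟩
    0#      ∎)

  ^≈1-quotient : ∀ {x y z} n → x ≉ 0# → x ^ n ≈ 1# → y ^ n ≈ 1# → x * z ≈ y → z ^ n ≈ 1#
  ^≈1-quotient {x} {y} {z} n x≉0 xⁿ≈1 yⁿ≈1 xz≈y = *-cancelˡ (^-nonzero n x≉0) (begin
    x ^ n * z ^ n ≈⟨ ^-distrib-* x z n ⟨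
    (x * z) ^ n   ≈⟨ ^-congˡ n xz≈y ⟩
    y ^ n         ≈⟨ (yⁿ≈1 ⟨ trans ⟩ sym xⁿ≈1) ⟩
    x ^ n         ≈⟨ *-identityʳ _ ⟨
    x ^ n * 1#    ∎)

  ^≈1-coprime : ∀ {x m n} → Coprime m n → x ^ m ≈ 1# → x ^ n ≈ 1# → x ≈ 1#
  ^≈1-coprime {x} {m} {n} m⊥n xᵐ≈1 xⁿ≈1 = fromBézout (coprime-Bézout m⊥n)
    where
    x≈1 : ∀ s t a b → 1 ℕ.+ s ℕ.* a ≡ t ℕ.* b → x ^ a ≈ 1# → x ^ b ≈ 1# → x ≈ 1#
    x≈1 s t a b 1+sa≡tb xᵃ≈1 xᵇ≈1 = begin
      x                     ≈⟨ *-identityʳ x ⟨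
      x * 1#                ≈⟨ *-congˡ (^-congˡ s xᵃ≈1 ⟨ trans ⟩ 1^n≈1 s) ⟨
      x * (x ^ a) ^ s       ≈⟨ *-congˡ (^-assocʳ x a s ⟨ trans ⟩ ^-congʳ x (ℕ.*-comm a s)) ⟩
      x ^ (1 ℕ.+ s ℕ.* a)   ≡⟨ ≡.cong (x ^_) 1+sa≡tb ⟩
      x ^ (t ℕ.* b)         ≈⟨ (^-assocʳ x b t ⟨ trans ⟩ ^-congʳ x (ℕ.*-comm b t)) ⟨
      (x ^ b) ^ t           ≈⟨ (^-congˡ t xᵇ≈1 ⟨ trans ⟩ 1^n≈1 t) ⟩
      1#                    ∎
    fromBézout : Bézout.Identity 1 m n → x ≈ 1#
    fromBézout (Bézout.Identity.+- u v 1+vn≡um) = x≈1 v u n m 1+vn≡um xⁿ≈1 xᵐ≈1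
    fromBézout (Bézout.Identity.-+ u v 1+um≡vn) = x≈1 u v m n 1+um≡vn xᵐ≈1 xⁿ≈1

  -1^[m+n] : ∀ m n → (- 1#) ^ (m ℕ.+ n) ≈ (- 1#) ^ m * (- 1#) ^ n
  -1^[m+n] = ^-homo-* (- 1#)

  -1*-1≈1 : - 1# * - 1# ≈ 1#
  -1*-1≈1 = solve 0 ((:- con (+ 1)) :* (:- con (+ 1)) := con (+ 1)) refl

  -1^[2n]≈1 : ∀ n → (- 1#) ^ (2 ℕ.* n) ≈ 1#
  -1^[2n]≈1 n = x*x≈1⇒x^[2n]≈1 n -1*-1≈1

  -1^n*-1^n≈1 : ∀ n → (- 1#) ^ n * (- 1#) ^ n ≈ 1#
  -1^n*-1^n≈1 n = sym (x^[2n]≈x^n*x^n (- 1#) n) ⟨ trans ⟩ -1^[2n]≈1 n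

  -1^n≈-1^[n%2] : ∀ n → (- 1#) ^ n ≈ (- 1#) ^ (n ℕ.% 2)
  -1^n≈-1^[n%2] n = begin
    (- 1#) ^ n                                      ≡⟨ ≡.cong ((- 1#) ^_) (ℕ.m≡m%n+[m/n]*n n 2) ⟩
    (- 1#) ^ (n ℕ.% 2 ℕ.+ (n ℕ./ 2) ℕ.* 2)          ≈⟨ -1^[m+n] (n ℕ.% 2) _ ⟩
    (- 1#) ^ (n ℕ.% 2) * (- 1#) ^ ((n ℕ./ 2) ℕ.* 2) ≈⟨ *-congˡ (^-congʳ (- 1#) (ℕ.*-comm (n ℕ./ 2) 2) ⟨ trans ⟩ -1^[2n]≈1 (n ℕ./ 2)) ⟩
    (- 1#) ^ (n ℕ.% 2) * 1#                         ≈⟨ *-identityʳ _ ⟩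
    (- 1#) ^ (n ℕ.% 2)                              ∎

  %2-cong⇒-1^≈ : ∀ m n → m ℕ.% 2 ≡ n ℕ.% 2 → (- 1#) ^ m ≈ (- 1#) ^ n
  %2-cong⇒-1^≈ m n m≡n = -1^n≈-1^[n%2] m ⟨ trans ⟩ ≡.subst (λ k → (- 1#) ^ (m ℕ.% 2) ≈ (- 1#) ^ k) m≡n refl ⟨ trans ⟩ sym (-1^n≈-1^[n%2] n)

  -1^≈⇒%2-cong : 1# ≉ - 1# → ∀ m n → (- 1#) ^ m ≈ (- 1#) ^ n → m ℕ.% 2 ≡ n ℕ.% 2
  -1^≈⇒%2-cong 1≉-1 m n -1ᵐ≈-1ⁿ = residues (m ℕ.% 2) (n ℕ.% 2) (ℕ.m%n<n m 2) (ℕ.m%n<n n 2)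
    (sym (-1^n≈-1^[n%2] m) ⟨ trans ⟩ -1ᵐ≈-1ⁿ ⟨ trans ⟩ -1^n≈-1^[n%2] n)
    where
    residues : ∀ a b → a ℕ.< 2 → b ℕ.< 2 → (- 1#) ^ a ≈ (- 1#) ^ b → a ≡ b
    residues 0 0 _ _ _      = ≡.refl
    residues 1 1 _ _ _      = ≡.refl
    residues 0 1 _ _ 1≈-1   = ⊥-elim (1≉-1 (1≈-1 ⟨ trans ⟩ *-identityʳ (- 1#)))
    residues 1 0 _ _ -1≈1   = ⊥-elim (1≉-1 (sym (sym (*-identityʳ (- 1#)) ⟨ trans ⟩ -1≈1)))
    residues (suc (suc _)) _ (ℕ.s≤s (ℕ.s≤s ())) _ _
    residues _ (suc (suc _)) _ (ℕ.s≤s (ℕ.s≤s ())) _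

module Characteristic (K : Field) {p} (p-prime : Prime p) (char-p : HasChar K p) where

  import Data.Nat.Properties as ℕ
  open import Data.Nat.Combinatorics using (_C_; nCn≡1)
  open import Data.Nat.Primality using (prime⇒nonZero; prime⇒nonTrivial)
  open import Data.Nat.Divisibility using (_∣_; _∣?_; divides; ∣⇒≤)
  open import Data.Fin as Fin using (Fin; toℕ; fromℕ; inject₁)
  import Data.Fin.Properties as Fin
  open import Relation.Nullary using (yes; no)
  open import Data.Nat.Tactic.RingSolver using (solve-∀)
  open import Relation.Nullary.Negation using (contradiction)
  open import Function.Base using (_⟨_⟩_)
  open Combinatorics using (prime∣C; prime∤⇒coprime)
  open FieldTheory K
  open import Algebra.Properties.CommutativeSemigroup *-commutativeSemigroup using (x∙yz≈y∙xz)
  open import Algebra.Properties.CommutativeSemiring.Binomial commutativeSemiring using (theorem; binomialTerm)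
  open import Algebra.Properties.Semiring.Mult semiring using (_×_; ×-assoc-*; ×-congʳ)
  open import Algebra.Properties.Monoid.Sum +-monoid using (sum; sum-init-last; sum-cong-≋; sum-replicate-zero)

  p∣n⇒ι≈0 : ∀ {n} → p ∣ n → ι n ≈ 0#
  p∣n⇒ι≈0 (divides q ≡.refl) = ι[a*b]≈0 q char-p

  ι≈0⇒p∣n : ∀ {n} → ι n ≈ 0# → p ∣ n
  ι≈0⇒p∣n {n} ιn≈0 with p ∣? n
  ... | yes p∣n = p∣n
  ... | no  p∤n = contradiction ιn≈0 (coprime⇒ι≉0 (prime∤⇒coprime p-prime p∤n) char-p)

  p∣n⇒n×x≈0 : ∀ {n} x → p ∣ n → n × x ≈ 0#
  p∣n⇒n×x≈0 {n} x p∣n = begin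
    n × x          ≈⟨ ×-congʳ n (*-identityˡ x) ⟨
    n × (1# * x)   ≈⟨ ×-assoc-* n 1# x ⟨
    (n × 1#) * x   ≡⟨ ≡.cong (_* x) (≡.sym (ι≡× n)) ⟩
    ι n * x        ≈⟨ *-congʳ (p∣n⇒ι≈0 p∣n) ⟩
    0# * x         ≈⟨ zeroˡ x ⟩
    0#             ∎

  frobenius : ∀ x → (x + 1#) ^ p ≈ x ^ p + 1#
  frobenius x = expand (ℕ.suc-pred p ⦃ prime⇒nonZero p-prime ⦄)
    where
    expand : ∀ {q} → suc q ≡ p → (x + 1#) ^ p ≈ x ^ p + 1#
    expand {q} ≡.refl = begin
      (x + 1#) ^ suc q                                                      ≈⟨ theorem (suc q) x 1# ⟩
      term Fin.zero + sum (λ i → term (Fin.suc i))                          ≈⟨ +-congˡ (sum-init-last (λ i → term (Fin.suc i))) ⟩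
      term Fin.zero + (sum (λ i → term (Fin.suc (inject₁ i))) + term (fromℕ (suc q))) ≈⟨ +-cong first (+-cong middle last) ⟩
      1# + (0# + x ^ suc q)                                                 ≈⟨ (+-comm 1# _ ⟨ trans ⟩ +-congʳ (+-identityˡ _)) ⟩
      x ^ suc q + 1#                                                        ∎
      where
      term : Fin (suc (suc q)) → Carrier
      term = binomialTerm x 1# (suc q)
      first : term Fin.zero ≈ 1#
      first = +-identityʳ _ ⟨ trans ⟩ *-identityˡ _ ⟨ trans ⟩ 1^n≈1 (suc q)
      middle : sum (λ i → term (Fin.suc (inject₁ i))) ≈ 0#
      middle = sum-cong-≋ (λ i → p∣n⇒n×x≈0 _ (prime∣C p-prime (ℕ.s≤s ℕ.z≤n) (ℕ.s≤s (inner i)))) ⟨ trans ⟩ sum-replicate-zero q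
        where
        inner : ∀ i → toℕ (inject₁ i) ℕ.< q
        inner i = ≡.subst (ℕ._< q) (≡.sym (Fin.toℕ-inject₁ i)) (Fin.toℕ<n i)
      last : term (fromℕ (suc q)) ≈ x ^ suc q
      last rewrite Fin.toℕ-fromℕ q | nCn≡1 (suc q) | ℕ.n∸n≡0 q = +-identityʳ _ ⟨ trans ⟩ *-identityʳ _

  0^p≈0 : 0# ^ p ≈ 0#
  0^p≈0 = ≡.subst (λ k → 0# ^ k ≈ 0#) (ℕ.suc-pred p ⦃ prime⇒nonZero p-prime ⦄) (zeroˡ _)

  fermat : ∀ n → ι n ^ p ≈ ι n
  fermat zero    = 0^p≈0
  fermat (suc n) = begin
    (1# + ι n) ^ p  ≈⟨ ^-congˡ p (+-comm 1# (ι n)) ⟩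
    (ι n + 1#) ^ p  ≈⟨ frobenius (ι n) ⟩
    ι n ^ p + 1#    ≈⟨ +-congʳ (fermat n) ⟩
    ι n + 1#        ≈⟨ +-comm (ι n) 1# ⟩
    1# + ι n        ∎

  fermat-nonzero : ∀ n → ι n ≉ 0# → ι n ^ (p ℕ.∸ 1) ≈ 1#
  fermat-nonzero n ιn≉0 = *-cancelˡ ιn≉0 (begin
    ι n * ι n ^ (p ℕ.∸ 1) ≡⟨ ≡.cong (ι n ^_) (ℕ.suc-pred p ⦃ prime⇒nonZero p-prime ⦄) ⟩
    ι n ^ p               ≈⟨ fermat n ⟩
    ι n                   ≈⟨ *-identityʳ (ι n) ⟨
    ι n * 1#              ∎)

  module OddCharacteristic {p′} (p≡1+2p′ : p ≡ suc (2 ℕ.* p′)) where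

    open Combinatorics using (∏<; ∏<-+; ∏<-reverse; evens; odds; evens≡2^n*n!; evens*odds≡[h+r]!; prime∤!; ⌈n/2⌉≡⌊n/2⌋⊎1+⌊n/2⌋)

    -- Gauss's lemma for 2: 2^p′·p′! is the product of 2, 4, …, 2p′, and each of its ⌈p′/2⌉ factors
    -- beyond p′ is p minus an odd number; the odd numbers so obtained together with the small evens give p′! again.
    gauss-lemma : ι 2 ^ p′ ≈ (- 1#) ^ ℕ.⌈ p′ /2⌉
    gauss-lemma = *-cancelˡ ι[p′!]≉0 (begin
      ι (p′ ℕ.!) * ι 2 ^ p′                           ≈⟨ *-comm _ _ ⟩
      ι 2 ^ p′ * ι (p′ ℕ.!)                           ≈⟨ *-congʳ (ι-^ 2 p′) ⟨
      ι (2 ℕ.^ p′) * ι (p′ ℕ.!)                       ≈⟨ ι-* (2 ℕ.^ p′) (p′ ℕ.!) ⟨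
      ι (2 ℕ.^ p′ ℕ.* p′ ℕ.!)                         ≡⟨ ≡.cong ι (≡.sym (evens≡2^n*n! p′)) ⟩
      ι (evens p′)                                    ≡⟨ ≡.cong (λ n → ι (evens n)) (≡.sym h+r≡p′) ⟩
      ι (evens (h ℕ.+ r))                             ≡⟨ ≡.cong ι (∏<-+ h r _) ⟩
      ι (evens h ℕ.* ∏< r upperEven)                  ≈⟨ ι-* (evens h) _ ⟩
      ι (evens h) * ι (∏< r upperEven)                ≈⟨ *-congˡ (ι-∏<-negate r upperEven _ upperEven≈-odd) ⟩
      ι (evens h) * (sign * ι (∏< r (λ s → suc (2 ℕ.* (r ℕ.∸ suc s))))) ≡⟨ ≡.cong (λ n → ι (evens h) * (sign * ι n)) (∏<-reverse r _) ⟩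
      ι (evens h) * (sign * ι (odds r))               ≈⟨ x∙yz≈y∙xz (ι (evens h)) sign _ ⟩
      sign * (ι (evens h) * ι (odds r))               ≈⟨ *-congˡ (ι-* (evens h) (odds r)) ⟨
      sign * ι (evens h ℕ.* odds r)                   ≡⟨ ≡.cong (λ n → sign * ι n) (evens*odds≡[h+r]! h r (⌈n/2⌉≡⌊n/2⌋⊎1+⌊n/2⌋ p′)) ⟩
      sign * ι ((h ℕ.+ r) ℕ.!)                        ≡⟨ ≡.cong (λ n → sign * ι (n ℕ.!)) h+r≡p′ ⟩
      sign * ι (p′ ℕ.!)                               ≈⟨ *-comm sign _ ⟩
      ι (p′ ℕ.!) * sign                               ∎)
      where
      h r : ℕ
      h = ℕ.⌊ p′ /2⌋
      r = ℕ.⌈ p′ /2⌉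
      sign : Carrier
      sign = (- 1#) ^ r
      h+r≡p′ : h ℕ.+ r ≡ p′
      h+r≡p′ = ℕ.⌊n/2⌋+⌈n/2⌉≡n p′
      upperEven : ℕ → ℕ
      upperEven s = 2 ℕ.* suc (h ℕ.+ s)
      upperEven≈-odd : ∀ s → s ℕ.< r → ι (upperEven s) ≈ - ι (suc (2 ℕ.* (r ℕ.∸ suc s)))
      upperEven≈-odd s s<r = +-inverseˡ-unique _ _ (sym (ι-+ (upperEven s) _) ⟨ trans ⟩ ≡.subst (λ n → ι n ≈ 0#) (≡.sym sum≡p) char-p)
        where
        sum≡p : upperEven s ℕ.+ suc (2 ℕ.* (r ℕ.∸ suc s)) ≡ p
        sum≡p = ≡.trans (regroup h s (r ℕ.∸ suc s))
                  (≡.trans (≡.cong (λ n → suc (2 ℕ.* (h ℕ.+ n))) (ℕ.m+[n∸m]≡n s<r))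
                    (≡.trans (≡.cong (λ n → suc (2 ℕ.* n)) h+r≡p′) (≡.sym p≡1+2p′)))
          where
          regroup : ∀ h s d → 2 ℕ.* suc (h ℕ.+ s) ℕ.+ suc (2 ℕ.* d) ≡ suc (2 ℕ.* (h ℕ.+ (suc s ℕ.+ d)))
          regroup = solve-∀
      ι[p′!]≉0 : ι (p′ ℕ.!) ≉ 0#
      ι[p′!]≉0 ι≈0 = prime∤! p′ p-prime p′<p (ι≈0⇒p∣n ι≈0)
        where
        p′<p : p′ ℕ.< p
        p′<p = ≡.subst (p′ ℕ.<_) (≡.sym p≡1+2p′) (ℕ.s≤s (ℕ.m≤n*m p′ 2))

    ι2≉0 : ι 2 ≉ 0#
    ι2≉0 ι2≈0 = ℕ.<⇒≱ 2<p (∣⇒≤ (ι≈0⇒p∣n ι2≈0))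
      where
      2<p : 2 ℕ.< p
      2<p = ≡.subst (2 ℕ.<_) (≡.sym p≡1+2p′) (odd>1⇒>2 p′ (≡.subst (1 ℕ.<_) p≡1+2p′ (ℕ.nonTrivial⇒n>1 p ⦃ prime⇒nonTrivial p-prime ⦄)))
        where
        odd>1⇒>2 : ∀ n → 1 ℕ.< suc (2 ℕ.* n) → 2 ℕ.< suc (2 ℕ.* n)
        odd>1⇒>2 zero (ℕ.s≤s ())
        odd>1⇒>2 (suc n) _ = ℕ.s≤s (ℕ.s≤s (ℕ.≤-trans (ℕ.s≤s ℕ.z≤n) (ℕ.m≤n+m _ n)))

    1≉-1 : 1# ≉ - 1#
    1≉-1 1≈-1 = ι2≉0 (+-congˡ (+-identityʳ 1#) ⟨ trans ⟩ +-congʳ 1≈-1 ⟨ trans ⟩ -‿inverseˡ 1#)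

    fermat-2p′ : ∀ n → ι n ≉ 0# → ι n ^ (2 ℕ.* p′) ≈ 1#
    fermat-2p′ n ιn≉0 = ≡.subst (λ k → ι n ^ k ≈ 1#) (≡.cong (ℕ._∸ 1) p≡1+2p′) (fermat-nonzero n ιn≉0)

module Polynomial (K : Field) where

  open import Data.List using (List; []; _∷_; map)
  open import Data.Product using (_×_; _,_)
  open import Function.Base using (_⟨_⟩_)
  open import Data.Integer using (+_)
  open FieldTheory K

  eval : Poly K → Carrier → Carrier
  eval []       x = 0#
  eval (c ∷ cs) x = c + x * eval cs x

  -- A′(x), from A = c + X·B ⇒ A′ = B + X·B′
  eval′ : Poly K → Carrier → Carrier
  eval′ []       x = 0#
  eval′ (c ∷ cs) x = eval cs x + x * eval′ cs x

  infix 4 _≋_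
  _≋_ : Poly K → Poly K → Set
  A ≋ B = ∀ i → coeff K A i ≈ coeff K B i

  zero-coeffs⇒eval≈0 : ∀ A x → (∀ i → coeff K A i ≈ 0#) → eval A x ≈ 0# × eval′ A x ≈ 0#
  zero-coeffs⇒eval≈0 []       x A≈0 = refl , refl
  zero-coeffs⇒eval≈0 (c ∷ cs) x A≈0 with zero-coeffs⇒eval≈0 cs x (λ i → A≈0 (suc i))
  ... | cs≈0 , cs′≈0 = (+-cong (A≈0 0) (*-congˡ cs≈0 ⟨ trans ⟩ zeroʳ x) ⟨ trans ⟩ +-identityʳ 0#)
                     , (+-cong cs≈0 (*-congˡ cs′≈0 ⟨ trans ⟩ zeroʳ x) ⟨ trans ⟩ +-identityʳ 0#)

  ≋⇒eval≈ : ∀ A B x → A ≋ B → eval A x ≈ eval B x × eval′ A x ≈ eval′ B x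
  ≋⇒eval≈ []       B        x A≋B with zero-coeffs⇒eval≈0 B x (λ i → sym (A≋B i))
  ... | B≈0 , B′≈0 = sym B≈0 , sym B′≈0
  ≋⇒eval≈ (a ∷ as) []       x A≋B = zero-coeffs⇒eval≈0 (a ∷ as) x A≋B
  ≋⇒eval≈ (a ∷ as) (b ∷ bs) x A≋B with ≋⇒eval≈ as bs x (λ i → A≋B (suc i))
  ... | as≈bs , as′≈bs′ = +-cong (A≋B 0) (*-congˡ as≈bs) , +-cong as≈bs (*-congˡ as′≈bs′)

  coeff-addP : ∀ A B i → coeff K (addP K A B) i ≈ coeff K A i + coeff K B i
  coeff-addP []       B        i       = sym (+-identityˡ _)
  coeff-addP (a ∷ as) []       zero    = sym (+-identityʳ _)
  coeff-addP (a ∷ as) []       (suc i) = sym (+-identityʳ _)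
  coeff-addP (a ∷ as) (b ∷ bs) zero    = refl
  coeff-addP (a ∷ as) (b ∷ bs) (suc i) = coeff-addP as bs i

  coeff-map : ∀ (φ : Carrier → Carrier) → φ 0# ≈ 0# → ∀ A i → coeff K (map φ A) i ≈ φ (coeff K A i)
  coeff-map φ φ0≈0 []       i       = sym φ0≈0
  coeff-map φ φ0≈0 (a ∷ as) zero    = refl
  coeff-map φ φ0≈0 (a ∷ as) (suc i) = coeff-map φ φ0≈0 as i

  -[a*0]≈0 : ∀ a → - (a * 0#) ≈ 0#
  -[a*0]≈0 a = -‿cong (zeroʳ a) ⟨ trans ⟩ -0#≈0#

  coeff-mulLin-zero : ∀ a A → coeff K (mulLin K a A) 0 ≈ - (a * coeff K A 0)
  coeff-mulLin-zero a A = coeff-addP (0# ∷ A) (map (λ c → - (a * c)) A) 0 ⟨ trans ⟩ +-identityˡ _ ⟨ trans ⟩ coeff-map (λ c → - (a * c)) (-[a*0]≈0 a) A 0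

  coeff-mulLin-suc : ∀ a A i → coeff K (mulLin K a A) (suc i) ≈ coeff K A i - a * coeff K A (suc i)
  coeff-mulLin-suc a A i = coeff-addP (0# ∷ A) (map (λ c → - (a * c)) A) (suc i) ⟨ trans ⟩ +-congˡ (coeff-map (λ c → - (a * c)) (-[a*0]≈0 a) A (suc i))

  mulLin-cong : ∀ a {A B} → A ≋ B → mulLin K a A ≋ mulLin K a B
  mulLin-cong a {A} {B} A≋B zero    = coeff-mulLin-zero a A ⟨ trans ⟩ -‿cong (*-congˡ (A≋B 0)) ⟨ trans ⟩ sym (coeff-mulLin-zero a B)
  mulLin-cong a {A} {B} A≋B (suc i) = coeff-mulLin-suc a A i ⟨ trans ⟩ +-cong (A≋B i) (-‿cong (*-congˡ (A≋B (suc i)))) ⟨ trans ⟩ sym (coeff-mulLin-suc a B i)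

  eval-addP : ∀ A B x → eval (addP K A B) x ≈ eval A x + eval B x
  eval-addP []       B        x = sym (+-identityˡ _)
  eval-addP (a ∷ as) []       x = sym (+-identityʳ _)
  eval-addP (a ∷ as) (b ∷ bs) x = +-congˡ (*-congˡ (eval-addP as bs x)) ⟨ trans ⟩
    solve 5 (λ a b x u v → (a :+ b) :+ x :* (u :+ v) := (a :+ x :* u) :+ (b :+ x :* v)) refl a b x (eval as x) (eval bs x)

  eval′-addP : ∀ A B x → eval′ (addP K A B) x ≈ eval′ A x + eval′ B x
  eval′-addP []       B        x = sym (+-identityˡ _)
  eval′-addP (a ∷ as) []       x = sym (+-identityʳ _)
  eval′-addP (a ∷ as) (b ∷ bs) x = +-cong (eval-addP as bs x) (*-congˡ (eval′-addP as bs x)) ⟨ trans ⟩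
    solve 5 (λ x u v s t → (u :+ v) :+ x :* (s :+ t) := (u :+ x :* s) :+ (v :+ x :* t)) refl x (eval as x) (eval bs x) (eval′ as x) (eval′ bs x)

  eval-negScale : ∀ a A x → eval (map (λ c → - (a * c)) A) x ≈ - (a * eval A x)
  eval-negScale a []       x = sym (-[a*0]≈0 a)
  eval-negScale a (c ∷ cs) x = +-congˡ (*-congˡ (eval-negScale a cs x)) ⟨ trans ⟩
    solve 4 (λ a c x u → (:- (a :* c)) :+ x :* (:- (a :* u)) := :- (a :* (c :+ x :* u))) refl a c x (eval cs x)

  eval′-negScale : ∀ a A x → eval′ (map (λ c → - (a * c)) A) x ≈ - (a * eval′ A x)
  eval′-negScale a []       x = sym (-[a*0]≈0 a)
  eval′-negScale a (c ∷ cs) x = +-cong (eval-negScale a cs x) (*-congˡ (eval′-negScale a cs x)) ⟨ trans ⟩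
    solve 4 (λ a u x v → (:- (a :* u)) :+ x :* (:- (a :* v)) := :- (a :* (u :+ x :* v))) refl a (eval cs x) x (eval′ cs x)

  eval-mulLin : ∀ a A x → eval (mulLin K a A) x ≈ (x - a) * eval A x
  eval-mulLin a A x = eval-addP (0# ∷ A) (map (λ c → - (a * c)) A) x ⟨ trans ⟩ +-congˡ (eval-negScale a A x) ⟨ trans ⟩
    solve 3 (λ x a u → (con (+ 0) :+ x :* u) :+ (:- (a :* u)) := (x :- a) :* u) refl x a (eval A x)

  eval′-mulLin : ∀ a A x → eval′ (mulLin K a A) x ≈ eval A x + (x - a) * eval′ A x
  eval′-mulLin a A x = eval′-addP (0# ∷ A) (map (λ c → - (a * c)) A) x ⟨ trans ⟩ +-congˡ (eval′-negScale a A x) ⟨ trans ⟩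
    solve 4 (λ x a u v → (u :+ x :* v) :+ (:- (a :* v)) := u :+ (x :- a) :* v) refl x a (eval A x) (eval′ A x)

  monomial : ℕ → Poly K
  monomial zero    = 1# ∷ []
  monomial (suc k) = 0# ∷ monomial k

  coeff-monomial : ∀ k i → coeff K (monomial k) i ≈ δ K i k
  coeff-monomial zero    zero    = refl
  coeff-monomial zero    (suc i) = refl
  coeff-monomial (suc k) zero    = refl
  coeff-monomial (suc k) (suc i) = coeff-monomial k i

  eval-monomial : ∀ k x → eval (monomial k) x ≈ x ^ k
  eval-monomial zero    x = +-congˡ (zeroʳ x) ⟨ trans ⟩ +-identityʳ 1#
  eval-monomial (suc k) x = +-identityˡ _ ⟨ trans ⟩ *-congˡ (eval-monomial k x)

  x*eval′-monomial : ∀ k x → x * eval′ (monomial k) x ≈ ι k * x ^ k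
  x*eval′-monomial zero    x = *-congˡ (+-identityˡ _ ⟨ trans ⟩ zeroʳ x) ⟨ trans ⟩ zeroʳ x ⟨ trans ⟩ sym (zeroˡ 1#)
  x*eval′-monomial (suc k) x = begin
    x * (eval (monomial k) x + x * eval′ (monomial k) x) ≈⟨ *-congˡ (+-cong (eval-monomial k x) (x*eval′-monomial k x)) ⟩
    x * (x ^ k + ι k * x ^ k)                             ≈⟨ solve 3 (λ x u w → x :* (u :+ w :* u) := (con (+ 1) :+ w) :* (x :* u)) refl x (x ^ k) (ι k) ⟩
    (1# + ι k) * (x * x ^ k)                              ∎

  trinomial : ℕ → ℕ → Poly K
  trinomial n m = addP K (addP K (monomial n) (map -_ (monomial m))) (monomial 0)

  coeff-trinomial : ∀ n m i → coeff K (trinomial n m) i ≈ (δ K i n + - δ K i m) + δ K i 0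
  coeff-trinomial n m i =
    coeff-addP (addP K (monomial n) (map -_ (monomial m))) (monomial 0) i ⟨ trans ⟩
    +-cong (coeff-addP (monomial n) (map -_ (monomial m)) i ⟨ trans ⟩
            +-cong (coeff-monomial n i) (coeff-map -_ -0#≈0# (monomial m) i ⟨ trans ⟩ -‿cong (coeff-monomial m i)))
           (coeff-monomial 0 i)

  eval-neg : ∀ A x → eval (map -_ A) x ≈ - eval A x
  eval-neg []       x = sym -0#≈0#
  eval-neg (c ∷ cs) x = +-congˡ (*-congˡ (eval-neg cs x)) ⟨ trans ⟩
    solve 3 (λ c x u → (:- c) :+ x :* (:- u) := :- (c :+ x :* u)) refl c x (eval cs x)

  eval′-neg : ∀ A x → eval′ (map -_ A) x ≈ - eval′ A x
  eval′-neg []       x = sym -0#≈0#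
  eval′-neg (c ∷ cs) x = +-cong (eval-neg cs x) (*-congˡ (eval′-neg cs x)) ⟨ trans ⟩
    solve 3 (λ u x v → (:- u) :+ x :* (:- v) := :- (u :+ x :* v)) refl (eval cs x) x (eval′ cs x)

  eval-trinomial : ∀ n m x → eval (trinomial n m) x ≈ (x ^ n - x ^ m) + 1#
  eval-trinomial n m x =
    eval-addP (addP K (monomial n) (map -_ (monomial m))) (monomial 0) x ⟨ trans ⟩
    +-cong (eval-addP (monomial n) (map -_ (monomial m)) x ⟨ trans ⟩
            +-cong (eval-monomial n x) (eval-neg (monomial m) x ⟨ trans ⟩ -‿cong (eval-monomial m x)))
           (eval-monomial 0 x)

  x*eval′-trinomial : ∀ n m x → x * eval′ (trinomial n m) x ≈ ι n * x ^ n - ι m * x ^ m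
  x*eval′-trinomial n m x = begin
    x * eval′ (trinomial n m) x
      ≈⟨ *-congˡ (eval′-addP (addP K (monomial n) (map -_ (monomial m))) (monomial 0) x ⟨ trans ⟩
                  +-cong (eval′-addP (monomial n) (map -_ (monomial m)) x ⟨ trans ⟩ +-congˡ (eval′-neg (monomial m) x))
                         (+-identityˡ _ ⟨ trans ⟩ zeroʳ x)) ⟩
    x * ((eval′ (monomial n) x - eval′ (monomial m) x) + 0#)
      ≈⟨ solve 3 (λ x u v → x :* ((u :- v) :+ con (+ 0)) := x :* u :- x :* v) refl x (eval′ (monomial n) x) (eval′ (monomial m) x) ⟩
    x * eval′ (monomial n) x - x * eval′ (monomial m) x
      ≈⟨ +-cong (x*eval′-monomial n x) (-‿cong (x*eval′-monomial m x)) ⟩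
    ι n * x ^ n - ι m * x ^ m ∎

  -- synthetic division by X - a; the quotient takes the value A′(a) at a
  quotient : Carrier → Poly K → Poly K
  quotient a []       = []
  quotient a (c ∷ cs) = eval cs a ∷ quotient a cs

  eval-quotient : ∀ a A → eval (quotient a A) a ≈ eval′ A a
  eval-quotient a []       = refl
  eval-quotient a (c ∷ cs) = +-congˡ (*-congˡ (eval-quotient a cs))

  division-with-remainder : ∀ a A i → coeff K A i ≈ coeff K (mulLin K a (quotient a A)) i + δ K i 0 * eval A a
  division-with-remainder a []       zero    = sym (+-identityˡ _ ⟨ trans ⟩ zeroʳ 1#)
  division-with-remainder a []       (suc i) = sym (+-identityˡ _ ⟨ trans ⟩ zeroʳ 0#)
  division-with-remainder a (c ∷ cs) zero    = begin
    c                                                           ≈⟨ solve 3 (λ c a r → c := (:- (a :* r)) :+ con (+ 1) :* (c :+ a :* r)) refl c a (eval cs a) ⟩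
    - (a * eval cs a) + 1# * (c + a * eval cs a)                ≈⟨ +-congʳ (coeff-mulLin-zero a (quotient a (c ∷ cs))) ⟨
    coeff K (mulLin K a (quotient a (c ∷ cs))) 0 + 1# * (c + a * eval cs a) ∎
  division-with-remainder a (c ∷ cs) (suc zero) = begin
    coeff K cs 0                                                ≈⟨ division-with-remainder a cs 0 ⟩
    coeff K (mulLin K a (quotient a cs)) 0 + 1# * eval cs a     ≈⟨ +-congʳ (coeff-mulLin-zero a (quotient a cs)) ⟩
    - (a * coeff K (quotient a cs) 0) + 1# * eval cs a          ≈⟨ solve 3 (λ a s r → (:- (a :* s)) :+ con (+ 1) :* r := (r :- a :* s) :+ con (+ 0) :* con (+ 0)) refl a (coeff K (quotient a cs) 0) (eval cs a) ⟩
    (eval cs a - a * coeff K (quotient a cs) 0) + 0# * 0#       ≈⟨ +-cong (sym (coeff-mulLin-suc a (quotient a (c ∷ cs)) 0)) (zeroˡ _ ⟨ trans ⟩ sym (zeroˡ _)) ⟩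
    coeff K (mulLin K a (quotient a (c ∷ cs))) 1 + 0# * eval (c ∷ cs) a ∎
  division-with-remainder a (c ∷ cs) (suc (suc k)) = begin
    coeff K cs (suc k)                                          ≈⟨ division-with-remainder a cs (suc k) ⟩
    coeff K (mulLin K a (quotient a cs)) (suc k) + 0# * eval cs a ≈⟨ +-cong (coeff-mulLin-suc a (quotient a cs) k) (zeroˡ _ ⟨ trans ⟩ sym (zeroˡ _)) ⟩
    (coeff K (quotient a cs) k - a * coeff K (quotient a cs) (suc k)) + 0# * eval (c ∷ cs) a ≈⟨ +-congʳ (sym (coeff-mulLin-suc a (quotient a (c ∷ cs)) (suc k))) ⟩
    coeff K (mulLin K a (quotient a (c ∷ cs))) (suc (suc k)) + 0# * eval (c ∷ cs) a ∎

  root⇒factor : ∀ a A → eval A a ≈ 0# → A ≋ mulLin K a (quotient a A)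
  root⇒factor a A A[a]≈0 i = division-with-remainder a A i ⟨ trans ⟩ +-congˡ (*-congˡ A[a]≈0 ⟨ trans ⟩ zeroʳ _) ⟨ trans ⟩ +-identityʳ _

  doubleRoot⇒eval≈0 : ∀ a q A → mulLin K a (mulLin K a q) ≋ A → eval A a ≈ 0# × eval′ A a ≈ 0#
  doubleRoot⇒eval≈0 a q A [X-a]²q≋A with ≋⇒eval≈ (mulLin K a (mulLin K a q)) A a [X-a]²q≋A
  ... | A[a]≈ , A′[a]≈ = (sym A[a]≈ ⟨ trans ⟩ vanishes (mulLin K a q))
                       , (sym A′[a]≈ ⟨ trans ⟩ eval′-mulLin a (mulLin K a q) a ⟨ trans ⟩
                          +-cong (vanishes q) (*-congʳ (-‿inverseʳ a) ⟨ trans ⟩ zeroˡ _) ⟨ trans ⟩ +-identityʳ 0#)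
    where
    vanishes : ∀ B → eval (mulLin K a B) a ≈ 0#
    vanishes B = eval-mulLin a B a ⟨ trans ⟩ *-congʳ (-‿inverseʳ a) ⟨ trans ⟩ zeroˡ _

  eval≈0⇒doubleRoot : ∀ a A → eval A a ≈ 0# → eval′ A a ≈ 0# → A ≋ mulLin K a (mulLin K a (quotient a (quotient a A)))
  eval≈0⇒doubleRoot a A A[a]≈0 A′[a]≈0 i =
    root⇒factor a A A[a]≈0 i ⟨ trans ⟩
    mulLin-cong a {quotient a A} {mulLin K a (quotient a (quotient a A))} (root⇒factor a (quotient a A) (eval-quotient a A ⟨ trans ⟩ A′[a]≈0)) i

  module _ (p g : ℕ) {a : Carrier} where

    private
      n m : ℕ
      n = 2 ℕ.* g ℕ.+ 2
      m = 2 ℕ.* g ℕ.+ 3 ℕ.∸ p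

    repeatedRoot⇒ : RepeatedRootAt K p g a → (a ^ n - a ^ m) + 1# ≈ 0# × ι n * a ^ n - ι m * a ^ m ≈ 0#
    repeatedRoot⇒ (q , [X-a]²q≈f) with doubleRoot⇒eval≈0 a q (trinomial n m) (λ i → [X-a]²q≈f i ⟨ trans ⟩ sym (coeff-trinomial n m i))
    ... | f[a]≈0 , f′[a]≈0 = (sym (eval-trinomial n m a) ⟨ trans ⟩ f[a]≈0)
                           , (sym (x*eval′-trinomial n m a) ⟨ trans ⟩ *-congˡ f′[a]≈0 ⟨ trans ⟩ zeroʳ a)

    ⇒repeatedRoot : a ≉ 0# → (a ^ n - a ^ m) + 1# ≈ 0# → ι n * a ^ n - ι m * a ^ m ≈ 0# → RepeatedRootAt K p g a
    ⇒repeatedRoot a≉0 f[a]≈0 af′[a]≈0 =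
      quotient a (quotient a (trinomial n m)) , λ i → sym (eval≈0⇒doubleRoot a (trinomial n m) (eval-trinomial n m a ⟨ trans ⟩ f[a]≈0) f′[a]≈0 i) ⟨ trans ⟩ coeff-trinomial n m i
      where
      f′[a]≈0 : eval′ (trinomial n m) a ≈ 0#
      f′[a]≈0 = *-cancelˡ a≉0 (x*eval′-trinomial n m a ⟨ trans ⟩ af′[a]≈0 ⟨ trans ⟩ sym (zeroʳ a))

module Admissibility (K : Field) {p} (p-prime : Prime p) (char-p : HasChar K p)
                     {p′} (p≡1+2p′ : p ≡ suc (2 ℕ.* p′)) where

  import Data.Nat.Properties as ℕ
  open import Data.Integer using (+_)
  open import Data.Product using (Σ; _×_; _,_)
  open import Data.Sum using (_⊎_; inj₁; inj₂)
  open import Function.Base using (_⟨_⟩_)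
  open FieldTheory K
  open Characteristic K p-prime char-p
  open OddCharacteristic {p′} p≡1+2p′

  -- β is admissible when a square root a of β would satisfy a^(p-1) = -1 and 2aⁿ = -1, for n = 2p′k + 2j′
  Admissible : ℕ → ℕ → Carrier → Set
  Admissible k j′ β = β ^ p′ ≈ - 1# × ι 2 * (- 1#) ^ k * β ^ j′ ≈ - 1#

  module _ {k j′} (sign≈ : (- 1#) ^ (ℕ.⌈ p′ /2⌉ ℕ.+ k ℕ.* p′ ℕ.+ j′) ≈ (- 1#) ^ p′) where

    half : Carrier
    half = x⁻¹ (ι 2) ι2≉0

    e : Carrier
    e = - ((- 1#) ^ k * half)

    2[-1]ᵏe≈-1 : ι 2 * (- 1#) ^ k * e ≈ - 1#
    2[-1]ᵏe≈-1 = begin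
      ι 2 * (- 1#) ^ k * - ((- 1#) ^ k * half)      ≈⟨ solve 3 (λ t s h → t :* s :* (:- (s :* h)) := :- ((s :* s) :* (t :* h))) refl (ι 2) ((- 1#) ^ k) half ⟩
      - (((- 1#) ^ k * (- 1#) ^ k) * (ι 2 * half))  ≈⟨ -‿cong (*-cong (-1^n*-1^n≈1 k) (x*x⁻¹≈1 (ι 2) ι2≉0) ⟨ trans ⟩ *-identityʳ 1#) ⟩
      - 1#                                          ∎

    eᵖ′≈[-1]ʲ′ : e ^ p′ ≈ (- 1#) ^ j′
    eᵖ′≈[-1]ʲ′ = *-cancelˡ (x*x≈1⇒x≉0 (-1^n*-1^n≈1 (ℕ.⌈ p′ /2⌉ ℕ.+ k ℕ.* p′))) (begin
      σ * e ^ p′                                ≈⟨ *-congʳ (-1^[m+n] ℕ.⌈ p′ /2⌉ (k ℕ.* p′) ⟨ trans ⟩ *-cong (sym gauss-lemma) (sym (^-assocʳ (- 1#) k p′))) ⟩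
      ι 2 ^ p′ * ((- 1#) ^ k) ^ p′ * e ^ p′      ≈⟨ (*-congʳ (sym (^-distrib-* (ι 2) ((- 1#) ^ k) p′)) ⟨ trans ⟩ sym (^-distrib-* (ι 2 * (- 1#) ^ k) e p′)) ⟩
      (ι 2 * (- 1#) ^ k * e) ^ p′                ≈⟨ ^-congˡ p′ 2[-1]ᵏe≈-1 ⟩
      (- 1#) ^ p′                                ≈⟨ sign≈ ⟨
      (- 1#) ^ (ℕ.⌈ p′ /2⌉ ℕ.+ k ℕ.* p′ ℕ.+ j′)   ≈⟨ -1^[m+n] (ℕ.⌈ p′ /2⌉ ℕ.+ k ℕ.* p′) j′ ⟩
      σ * (- 1#) ^ j′                            ∎)
      where
      σ : Carrier
      σ = (- 1#) ^ (ℕ.⌈ p′ /2⌉ ℕ.+ k ℕ.* p′)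

    admissible-from : ∀ {β} → β ^ p′ ≈ - 1# → β ^ j′ ≈ e → Σ Carrier (Admissible k j′)
    admissible-from {β} βᵖ′≈-1 βʲ′≈e = β , βᵖ′≈-1 , (*-congˡ βʲ′≈e ⟨ trans ⟩ 2[-1]ᵏe≈-1)

    admissible-exists : p′ ≡ 1 ⊎ Σ ℕ (λ u → Σ ℕ (λ t → u ℕ.* j′ ≡ suc (t ℕ.* p′))) → Σ Carrier (Admissible k j′)
    admissible-exists (inj₁ p′≡1) = admissible-from
      (^-congʳ (- 1#) p′≡1 ⟨ trans ⟩ *-identityʳ (- 1#))
      (sym eᵖ′≈[-1]ʲ′ ⟨ trans ⟩ ^-congʳ e p′≡1 ⟨ trans ⟩ *-identityʳ e)
    -- β = (-1)ᵗ eᵘ: u inverts j′ modulo p′, and the sign (-1)ᵗ repairs e^(t p′) = (-1)^(t j′).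
    admissible-exists (inj₂ (u , t , uj′≡1+tp′)) = admissible-from βᵖ′≈-1 βʲ′≈e
      where
      τ : Carrier
      τ = (- 1#) ^ (t ℕ.* p′)
      e^[uj′] : e ^ (u ℕ.* j′) ≈ e * (- 1#) ^ (t ℕ.* j′)
      e^[uj′] = ^-congʳ e uj′≡1+tp′ ⟨ trans ⟩ *-congˡ (^-congʳ e (ℕ.*-comm t p′) ⟨ trans ⟩ sym (^-assocʳ e p′ t) ⟨ trans ⟩ ^-congˡ t eᵖ′≈[-1]ʲ′ ⟨ trans ⟩ ^-assocʳ (- 1#) j′ t ⟨ trans ⟩ ^-congʳ (- 1#) (ℕ.*-comm j′ t))
      βᵖ′≈-1 : ((- 1#) ^ t * e ^ u) ^ p′ ≈ - 1#
      βᵖ′≈-1 = begin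
        ((- 1#) ^ t * e ^ u) ^ p′         ≈⟨ ^-distrib-* _ _ p′ ⟩
        ((- 1#) ^ t) ^ p′ * (e ^ u) ^ p′  ≈⟨ *-cong (^-assocʳ (- 1#) t p′) (^-comm e u p′ ⟨ trans ⟩ ^-congˡ u eᵖ′≈[-1]ʲ′ ⟨ trans ⟩ ^-assocʳ (- 1#) j′ u ⟨ trans ⟩ ^-congʳ (- 1#) (≡.trans (ℕ.*-comm j′ u) uj′≡1+tp′)) ⟩
        τ * (- 1# * τ)                     ≈⟨ solve 2 (λ s m → s :* (m :* s) := m :* (s :* s)) refl τ (- 1#) ⟩
        - 1# * (τ * τ)                     ≈⟨ (*-congˡ (-1^n*-1^n≈1 (t ℕ.* p′)) ⟨ trans ⟩ *-identityʳ (- 1#)) ⟩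
        - 1#                               ∎
      βʲ′≈e : ((- 1#) ^ t * e ^ u) ^ j′ ≈ e
      βʲ′≈e = begin
        ((- 1#) ^ t * e ^ u) ^ j′            ≈⟨ ^-distrib-* _ _ j′ ⟩
        ((- 1#) ^ t) ^ j′ * (e ^ u) ^ j′     ≈⟨ *-cong (^-assocʳ (- 1#) t j′) (^-assocʳ e u j′ ⟨ trans ⟩ e^[uj′]) ⟩
        (- 1#) ^ (t ℕ.* j′) * (e * (- 1#) ^ (t ℕ.* j′)) ≈⟨ solve 2 (λ s e → s :* (e :* s) := e :* (s :* s)) refl ((- 1#) ^ (t ℕ.* j′)) e ⟩
        e * ((- 1#) ^ (t ℕ.* j′) * (- 1#) ^ (t ℕ.* j′)) ≈⟨ (*-congˡ (-1^n*-1^n≈1 (t ℕ.* j′)) ⟨ trans ⟩ *-identityʳ e) ⟩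
        e                                    ∎

module TrinomialRoots (K : Field) {p} (p-prime : Prime p) (char-p : HasChar K p)
                      {p′} (p≡1+2p′ : p ≡ suc (2 ℕ.* p′)) {m n} (n≡m+2p′ : n ≡ m ℕ.+ 2 ℕ.* p′) where

  import Data.Nat.Properties as ℕ
  open import Data.Nat.Divisibility using (_∣_)
  open import Data.Nat.Coprimality using (Coprime)
  open import Data.Integer using (+_)
  open import Data.Nat.Tactic.RingSolver using (solve-∀)
  open import Data.Product using (_×_; _,_)
  open import Function.Base using (_⟨_⟩_)
  open FieldTheory K
  open Characteristic K p-prime char-p
  open OddCharacteristic {p′} p≡1+2p′
  open Admissibility K p-prime char-p {p′} p≡1+2p′ using (Admissible)

  ι-m≈1+ι-n : ι m ≈ 1# + ι n
  ι-m≈1+ι-n = begin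
    ι m              ≈⟨ (+-congˡ char-p ⟨ trans ⟩ +-identityʳ _) ⟨
    ι m + ι p        ≈⟨ ι-+ m p ⟨
    ι (m ℕ.+ p)      ≡⟨ ≡.cong ι (≡.trans (≡.cong (m ℕ.+_) p≡1+2p′) (≡.trans (ℕ.+-suc m _) (≡.cong suc (≡.sym n≡m+2p′)))) ⟩
    ι (suc n)        ∎

  module DoubleRoot {e} (n≡2e : n ≡ 2 ℕ.* e) (e⊥p′ : Coprime e p′) (1≤m : 1 ℕ.≤ m)
                    {a} (f[a]≈0 : (a ^ n - a ^ m) + 1# ≈ 0#) (af′[a]≈0 : ι n * a ^ n - ι m * a ^ m ≈ 0#) where

    c : Carrier
    c = a ^ (2 ℕ.* p′)

    aⁿ≈aᵐc : a ^ n ≈ a ^ m * c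
    aⁿ≈aᵐc = ^-congʳ a n≡m+2p′ ⟨ trans ⟩ ^-homo-* a m (2 ℕ.* p′)

    aᵐc-aᵐ+1≈0 : (a ^ m * c - a ^ m) + 1# ≈ 0#
    aᵐc-aᵐ+1≈0 = +-congʳ (+-congʳ (sym aⁿ≈aᵐc)) ⟨ trans ⟩ f[a]≈0

    aᵐ≉0 : a ^ m ≉ 0#
    aᵐ≉0 aᵐ≈0 = 1≉0 (begin
      1#                                        ≈⟨ solve 2 (λ x c → con (+ 1) := (x :* c :- x) :+ con (+ 1) :- (x :* c :- x)) refl (a ^ m) c ⟩
      ((a ^ m * c - a ^ m) + 1#) - (a ^ m * c - a ^ m) ≈⟨ +-cong aᵐc-aᵐ+1≈0 (-‿cong (+-cong (*-congʳ aᵐ≈0 ⟨ trans ⟩ zeroˡ c) (-‿cong aᵐ≈0))) ⟩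
      0# - (0# - 0#)                            ≈⟨ solve 0 (con (+ 0) :- (con (+ 0) :- con (+ 0)) := con (+ 0)) refl ⟩
      0#                                        ∎)

    ι-n*c≈ι-m : ι n * c ≈ ι m
    ι-n*c≈ι-m = x∙y⁻¹≈ε⇒x≈y _ _ (*-cancelˡ aᵐ≉0 (begin
      a ^ m * (ι n * c - ι m)          ≈⟨ solve 4 (λ x N c M → x :* (N :* c :- M) := N :* (x :* c) :- M :* x) refl (a ^ m) (ι n) c (ι m) ⟩
      ι n * (a ^ m * c) - ι m * a ^ m  ≈⟨ +-congʳ (*-congˡ (sym aⁿ≈aᵐc)) ⟩
      ι n * a ^ n - ι m * a ^ m        ≈⟨ af′[a]≈0 ⟩
      0#                               ≈⟨ zeroʳ _ ⟨
      a ^ m * 0#                       ∎))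

    aᵐ≈-ι-n : a ^ m ≈ - ι n
    aᵐ≈-ι-n = +-inverseˡ-unique _ _ (begin
      a ^ m + ι n                                                         ≈⟨ solve 3 (λ x N c → x :+ N := N :* ((x :* c :- x) :+ con (+ 1)) :- x :* (N :* c :- (con (+ 1) :+ N))) refl (a ^ m) (ι n) c ⟩
      ι n * ((a ^ m * c - a ^ m) + 1#) - a ^ m * (ι n * c - (1# + ι n))  ≈⟨ +-cong (*-congˡ aᵐc-aᵐ+1≈0 ⟨ trans ⟩ zeroʳ _)
                                                                              (-‿cong (*-congˡ (+-cong ι-n*c≈ι-m (-‿cong (sym ι-m≈1+ι-n)) ⟨ trans ⟩ -‿inverseʳ _) ⟨ trans ⟩ zeroʳ _)) ⟩
      0# - 0#                                                             ≈⟨ -‿inverseʳ 0# ⟩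
      0#                                                                  ∎)

    ι-n≉0 : ι n ≉ 0#
    ι-n≉0 ι-n≈0 = aᵐ≉0 (aᵐ≈-ι-n ⟨ trans ⟩ -‿cong ι-n≈0 ⟨ trans ⟩ -0#≈0#)

    a≉0 : a ≉ 0#
    a≉0 a≈0 = aᵐ≉0 (aᵐ≈0 m 1≤m)
      where
      aᵐ≈0 : ∀ k → 1 ℕ.≤ k → a ^ k ≈ 0#
      aᵐ≈0 (suc k) _ = *-congʳ a≈0 ⟨ trans ⟩ zeroˡ _

    ι-m≉0 : ι m ≉ 0#
    ι-m≉0 ι-m≈0 = ^-nonzero (2 ℕ.* p′) a≉0 (*-cancelˡ ι-n≉0 (ι-n*c≈ι-m ⟨ trans ⟩ ι-m≈0 ⟨ trans ⟩ sym (zeroʳ (ι n))))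

    aⁿ≈-ι-m : a ^ n ≈ - ι m
    aⁿ≈-ι-m = aⁿ≈aᵐc ⟨ trans ⟩ *-congʳ aᵐ≈-ι-n ⟨ trans ⟩ sym (-‿distribˡ-* (ι n) c) ⟨ trans ⟩ -‿cong ι-n*c≈ι-m

    c^[2p′]≈1 : c ^ (2 ℕ.* p′) ≈ 1#
    c^[2p′]≈1 = ^≈1-quotient (2 ℕ.* p′) ι-n≉0 (fermat-2p′ n ι-n≉0) (fermat-2p′ m ι-m≉0) ι-n*c≈ι-m

    -- W = (a²)^(p-1) has Wᵉ = (aⁿ)^(p-1) = 1 as aⁿ = -m, and W^p′ = c^(p-1) = 1 as c = m/n; so W = c² is 1.
    c*c≈1 : c * c ≈ 1#
    c*c≈1 = begin
      c * c             ≈⟨ *-cong c≈bᵖ′ c≈bᵖ′ ⟩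
      b ^ p′ * b ^ p′   ≈⟨ x^[2n]≈x^n*x^n b p′ ⟨
      b ^ (2 ℕ.* p′)    ≈⟨ ^≈1-coprime e⊥p′ Wᵉ≈1 Wᵖ′≈1 ⟩
      1#                ∎
      where
      b : Carrier
      b = a * a
      c≈bᵖ′ : c ≈ b ^ p′
      c≈bᵖ′ = sym ([x*x]^n≈x^[2n] a p′)
      Wᵖ′≈1 : (b ^ (2 ℕ.* p′)) ^ p′ ≈ 1#
      Wᵖ′≈1 = ^-comm b (2 ℕ.* p′) p′ ⟨ trans ⟩ ^-congˡ (2 ℕ.* p′) ([x*x]^n≈x^[2n] a p′) ⟨ trans ⟩ c^[2p′]≈1
      Wᵉ≈1 : (b ^ (2 ℕ.* p′)) ^ e ≈ 1#
      Wᵉ≈1 = begin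
        (b ^ (2 ℕ.* p′)) ^ e          ≈⟨ ^-comm b (2 ℕ.* p′) e ⟩
        (b ^ e) ^ (2 ℕ.* p′)          ≈⟨ ^-congˡ (2 ℕ.* p′) ([x*x]^n≈x^[2n] a e ⟨ trans ⟩ ^-congʳ a (≡.sym n≡2e) ⟨ trans ⟩ aⁿ≈-ι-m) ⟩
        (- ι m) ^ (2 ℕ.* p′)          ≈⟨ [-x]^n (ι m) (2 ℕ.* p′) ⟩
        (- 1#) ^ (2 ℕ.* p′) * ι m ^ (2 ℕ.* p′) ≈⟨ *-cong (-1^[2n]≈1 p′) (fermat-2p′ m ι-m≉0) ⟩
        1# * 1#                       ≈⟨ *-identityʳ 1# ⟩
        1#                            ∎

    c≉1 : c ≉ 1#
    c≉1 c≈1 = 1≉0 (begin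
      1#                              ≈⟨ solve 2 (λ N M → con (+ 1) := (con (+ 1) :+ N :- M) :+ (M :- N :* con (+ 1))) refl (ι n) (ι m) ⟩
      (1# + ι n - ι m) + (ι m - ι n * 1#) ≈⟨ +-cong (+-congˡ (-‿cong ι-m≈1+ι-n) ⟨ trans ⟩ -‿inverseʳ _)
                                                   (+-congʳ (sym ι-n*c≈ι-m ⟨ trans ⟩ *-congˡ c≈1) ⟨ trans ⟩ -‿inverseʳ _) ⟩
      0# + 0#                         ≈⟨ +-identityʳ 0# ⟩
      0#                              ∎)

    c≈-1 : c ≈ - 1#
    c≈-1 = x*x≈1⇒x≈-1 c*c≈1 c≉1

    1+2ι-n≈0 : 1# + ι 2 * ι n ≈ 0#
    1+2ι-n≈0 = begin
      1# + ι 2 * ι n                       ≈⟨ solve 2 (λ N M → con (+ 1) :+ con (+ 2) :* N := (con (+ 1) :+ N :- M) :+ (M :- N :* (:- con (+ 1)))) refl (ι n) (ι m) ⟩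
      (1# + ι n - ι m) + (ι m - ι n * - 1#) ≈⟨ +-cong (+-congˡ (-‿cong ι-m≈1+ι-n) ⟨ trans ⟩ -‿inverseʳ _)
                                                      (+-congʳ (sym ι-n*c≈ι-m ⟨ trans ⟩ *-congˡ c≈-1) ⟨ trans ⟩ -‿inverseʳ _) ⟩
      0# + 0#                              ≈⟨ +-identityʳ 0# ⟩
      0#                                   ∎

    p∣1+2n : p ∣ suc (2 ℕ.* n)
    p∣1+2n = ι≈0⇒p∣n (+-congˡ (ι-* 2 n) ⟨ trans ⟩ 1+2ι-n≈0)

    module _ {k j′} (n≡2p′k+2j′ : n ≡ k ℕ.* (2 ℕ.* p′) ℕ.+ 2 ℕ.* j′) where

      2[-1]ᵏa²ʲ′≈-1 : ι 2 * (- 1#) ^ k * a ^ (2 ℕ.* j′) ≈ - 1#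
      2[-1]ᵏa²ʲ′≈-1 = begin
        ι 2 * (- 1#) ^ k * a ^ (2 ℕ.* j′)     ≈⟨ *-assoc _ _ _ ⟩
        ι 2 * ((- 1#) ^ k * a ^ (2 ℕ.* j′))   ≈⟨ *-congˡ (*-congʳ (^-congˡ k (sym c≈-1))) ⟩
        ι 2 * (c ^ k * a ^ (2 ℕ.* j′))        ≈⟨ *-congˡ (*-congʳ (^-assocʳ a (2 ℕ.* p′) k ⟨ trans ⟩ ^-congʳ a (ℕ.*-comm (2 ℕ.* p′) k))) ⟩
        ι 2 * (a ^ (k ℕ.* (2 ℕ.* p′)) * a ^ (2 ℕ.* j′)) ≈⟨ *-congˡ (^-homo-* a (k ℕ.* (2 ℕ.* p′)) (2 ℕ.* j′)) ⟨
        ι 2 * a ^ (k ℕ.* (2 ℕ.* p′) ℕ.+ 2 ℕ.* j′) ≈⟨ *-congˡ (^-congʳ a (≡.sym n≡2p′k+2j′) ⟨ trans ⟩ aⁿ≈-ι-m) ⟩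
        ι 2 * - ι m                           ≈⟨ *-congˡ (-‿cong ι-m≈1+ι-n) ⟩
        ι 2 * - (1# + ι n)                    ≈⟨ solve 2 (λ t N → t :* (:- (con (+ 1) :+ N)) := (:- con (+ 1) :- (con (+ 1) :+ t :* N)) :+ (con (+ 2) :- t)) refl (ι 2) (ι n) ⟩
        (- 1# - (1# + ι 2 * ι n)) + (ι 2 - ι 2) ≈⟨ +-cong (+-congˡ (-‿cong 1+2ι-n≈0 ⟨ trans ⟩ -0#≈0#) ⟨ trans ⟩ +-identityʳ _) (-‿inverseʳ _) ⟩
        - 1# + 0#                             ≈⟨ +-identityʳ _ ⟩
        - 1#                                  ∎

      parity : (ℕ.⌈ p′ /2⌉ ℕ.+ k ℕ.* p′ ℕ.+ j′) ℕ.% 2 ≡ p′ ℕ.% 2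
      parity = -1^≈⇒%2-cong 1≉-1 (ℕ.⌈ p′ /2⌉ ℕ.+ k ℕ.* p′ ℕ.+ j′) p′ (begin
        (- 1#) ^ (r ℕ.+ k ℕ.* p′ ℕ.+ j′)                 ≈⟨ (-1^[m+n] (r ℕ.+ k ℕ.* p′) j′ ⟨ trans ⟩ *-congʳ (-1^[m+n] r (k ℕ.* p′))) ⟩
        (- 1#) ^ r * (- 1#) ^ (k ℕ.* p′) * (- 1#) ^ j′   ≈⟨ *-cong (*-cong gauss-lemma (^-assocʳ (- 1#) k p′)) (A^p′≈c^j′ ⟨ trans ⟩ ^-congˡ j′ c≈-1) ⟨
        ι 2 ^ p′ * ((- 1#) ^ k) ^ p′ * A ^ p′            ≈⟨ *-congʳ (^-distrib-* (ι 2) ((- 1#) ^ k) p′) ⟨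
        (ι 2 * (- 1#) ^ k) ^ p′ * A ^ p′                 ≈⟨ ^-distrib-* (ι 2 * (- 1#) ^ k) A p′ ⟨
        (ι 2 * (- 1#) ^ k * A) ^ p′                      ≈⟨ ^-congˡ p′ 2[-1]ᵏa²ʲ′≈-1 ⟩
        (- 1#) ^ p′                                      ∎)
        where
        r : ℕ
        r = ℕ.⌈ p′ /2⌉
        A : Carrier
        A = a ^ (2 ℕ.* j′)
        A^p′≈c^j′ : A ^ p′ ≈ c ^ j′
        A^p′≈c^j′ = ^-assocʳ a (2 ℕ.* j′) p′ ⟨ trans ⟩ ^-congʳ a (exponents j′ p′) ⟨ trans ⟩ sym (^-assocʳ a (2 ℕ.* p′) j′)
          where
          exponents : ∀ j p → 2 ℕ.* j ℕ.* p ≡ 2 ℕ.* p ℕ.* j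
          exponents = solve-∀

  ⇒doubleRoot : ∀ {a} → a ^ (2 ℕ.* p′) ≈ - 1# → ι 2 * a ^ n ≈ - 1# → p ∣ suc (2 ℕ.* n)
              → (a ^ n - a ^ m) + 1# ≈ 0# × ι n * a ^ n - ι m * a ^ m ≈ 0#
  ⇒doubleRoot {a} a²ᵖ′≈-1 2aⁿ≈-1 p∣1+2n = f[a]≈0 , af′[a]≈0
    where
    aⁿ≈-aᵐ : a ^ n ≈ - a ^ m
    aⁿ≈-aᵐ = ^-congʳ a n≡m+2p′ ⟨ trans ⟩ ^-homo-* a m (2 ℕ.* p′) ⟨ trans ⟩ *-congˡ a²ᵖ′≈-1 ⟨ trans ⟩ *-comm _ _ ⟨ trans ⟩ -1*x≈-x _
    2aᵐ≈1 : ι 2 * a ^ m ≈ 1#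
    2aᵐ≈1 = begin
      ι 2 * a ^ m          ≈⟨ -‿involutive _ ⟨
      - - (ι 2 * a ^ m)    ≈⟨ -‿cong (-‿distribʳ-* (ι 2) (a ^ m) ⟨ trans ⟩ *-congˡ (sym aⁿ≈-aᵐ)) ⟩
      - (ι 2 * a ^ n)      ≈⟨ -‿cong 2aⁿ≈-1 ⟩
      - - 1#               ≈⟨ -‿involutive 1# ⟩
      1#                   ∎
    f[a]≈0 : (a ^ n - a ^ m) + 1# ≈ 0#
    f[a]≈0 = *-cancelˡ ι2≉0 (begin
      ι 2 * ((a ^ n - a ^ m) + 1#)       ≈⟨ solve 3 (λ t x y → t :* ((x :- y) :+ con (+ 1)) := (t :* x :- t :* y) :+ t) refl (ι 2) (a ^ n) (a ^ m) ⟩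
      (ι 2 * a ^ n - ι 2 * a ^ m) + ι 2  ≈⟨ +-congʳ (+-cong 2aⁿ≈-1 (-‿cong 2aᵐ≈1)) ⟩
      (- 1# - 1#) + ι 2                  ≈⟨ solve 0 (((:- con (+ 1)) :- con (+ 1)) :+ con (+ 2) := con (+ 0)) refl ⟩
      0#                                 ≈⟨ zeroʳ _ ⟨
      ι 2 * 0#                           ∎)
    af′[a]≈0 : ι n * a ^ n - ι m * a ^ m ≈ 0#
    af′[a]≈0 = *-cancelˡ ι2≉0 (begin
      ι 2 * (ι n * a ^ n - ι m * a ^ m)            ≈⟨ solve 5 (λ t N M x y → t :* (N :* x :- M :* y) := N :* (t :* x) :- M :* (t :* y)) refl (ι 2) (ι n) (ι m) (a ^ n) (a ^ m) ⟩
      ι n * (ι 2 * a ^ n) - ι m * (ι 2 * a ^ m)    ≈⟨ +-cong (*-congˡ 2aⁿ≈-1) (-‿cong (*-cong ι-m≈1+ι-n 2aᵐ≈1)) ⟩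
      ι n * - 1# - (1# + ι n) * 1#                 ≈⟨ solve 1 (λ N → N :* (:- con (+ 1)) :- (con (+ 1) :+ N) :* con (+ 1) := :- (con (+ 1) :+ con (+ 2) :* N)) refl (ι n) ⟩
      - (1# + ι 2 * ι n)                           ≈⟨ -‿cong (+-congˡ (sym (ι-* 2 n)) ⟨ trans ⟩ p∣n⇒ι≈0 p∣1+2n) ⟩
      - 0#                                         ≈⟨ -0#≈0# ⟩
      0#                                           ≈⟨ zeroʳ _ ⟨
      ι 2 * 0#                                     ∎)

  square-of-admissible : ∀ {k j′ β a} → n ≡ k ℕ.* (2 ℕ.* p′) ℕ.+ 2 ℕ.* j′ → Admissible k j′ β → a * a ≈ β
                       → a ^ (2 ℕ.* p′) ≈ - 1# × ι 2 * a ^ n ≈ - 1#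
  square-of-admissible {k} {j′} {β} {a} n≡2p′k+2j′ (βᵖ′≈-1 , 2[-1]ᵏβʲ′≈-1) a²≈β = a²ᵖ′≈-1 , 2aⁿ≈-1
    where
    a^[2i]≈βⁱ : ∀ i → a ^ (2 ℕ.* i) ≈ β ^ i
    a^[2i]≈βⁱ i = sym ([x*x]^n≈x^[2n] a i) ⟨ trans ⟩ ^-congˡ i a²≈β
    a²ᵖ′≈-1 : a ^ (2 ℕ.* p′) ≈ - 1#
    a²ᵖ′≈-1 = a^[2i]≈βⁱ p′ ⟨ trans ⟩ βᵖ′≈-1
    2aⁿ≈-1 : ι 2 * a ^ n ≈ - 1#
    2aⁿ≈-1 = begin
      ι 2 * a ^ n                                       ≈⟨ *-congˡ (^-congʳ a n≡2p′k+2j′ ⟨ trans ⟩ ^-homo-* a (k ℕ.* (2 ℕ.* p′)) (2 ℕ.* j′)) ⟩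
      ι 2 * (a ^ (k ℕ.* (2 ℕ.* p′)) * a ^ (2 ℕ.* j′))    ≈⟨ *-congˡ (*-cong (^-congʳ a (ℕ.*-comm k (2 ℕ.* p′)) ⟨ trans ⟩ sym (^-assocʳ a (2 ℕ.* p′) k) ⟨ trans ⟩ ^-congˡ k a²ᵖ′≈-1) (a^[2i]≈βⁱ j′)) ⟩
      ι 2 * ((- 1#) ^ k * β ^ j′)                        ≈⟨ *-assoc _ _ _ ⟨
      ι 2 * (- 1#) ^ k * β ^ j′                          ≈⟨ 2[-1]ᵏβʲ′≈-1 ⟩
      - 1#                                              ∎

module PrimeField {p} (p-prime : Prime p) where

  open import Level using (0ℓ)
  import Data.Nat.Properties as ℕ
  open import Data.Nat.Divisibility as ℕ using (_∤_)
  open import Data.Nat.Coprimality as Coprimality using (coprime-Bézout)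
  open import Data.Nat.GCD using (module Bézout)
  open import Data.Nat.Primality using (prime⇒nonTrivial)
  open import Data.Integer as ℤ using (ℤ; +_; -[1+_]; _-_)
  import Data.Integer.Properties as ℤ
  open import Data.Integer.Divisibility.Signed as ℤ using (divides)
  open import Data.Integer.Tactic.RingSolver using (solve-∀)
  open import Data.Product using (Σ; _,_)
  open import Relation.Binary.Structures using (IsEquivalence)
  open import Function.Base using (_⟨_⟩_)
  open import Algebra.Bundles using (CommutativeRing)
  open import Algebra.Structures using (IsCommutativeRing)
  open Combinatorics using (prime∤⇒coprime)

  -- a record rather than a definition, so that x and y can be recovered from the type x ≡ₚ y
  infix 4 _≡ₚ_
  record _≡ₚ_ (x y : ℤ) : Set where
    constructor mod-p
    field p∣x-y : + p ℤ.∣ x - y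
  open _≡ₚ_

  difference⇒≡ₚ : ∀ x y {z} → x - y ≡ z → + p ℤ.∣ z → x ≡ₚ y
  difference⇒≡ₚ x y x-y≡z p∣z = mod-p (≡.subst (+ p ℤ.∣_) (≡.sym x-y≡z) p∣z)

  ≡⇒≡ₚ : ∀ {x y} → x ≡ y → x ≡ₚ y
  ≡⇒≡ₚ {x} ≡.refl = difference⇒≡ₚ x x (ℤ.+-inverseʳ x) (divides (+ 0) ≡.refl)

  ≡ₚ-isEquivalence : IsEquivalence _≡ₚ_
  ≡ₚ-isEquivalence = record
    { refl  = ≡⇒≡ₚ ≡.refl
    ; sym   = λ {x} {y} x≡y → difference⇒≡ₚ y x (difference-sym x y) (ℤ.∣m⇒∣-m (p∣x-y x≡y))
    ; trans = λ {x} {y} {z} x≡y y≡z → difference⇒≡ₚ x z (difference-trans x y z) (ℤ.∣m∣n⇒∣m+n (p∣x-y x≡y) (p∣x-y y≡z))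
    }
    where
    difference-sym : ∀ x y → y - x ≡ ℤ.- (x - y)
    difference-sym = solve-∀
    difference-trans : ∀ x y z → x - z ≡ (x - y) ℤ.+ (y - z)
    difference-trans = solve-∀

  +-congₚ : ∀ {x y u v} → x ≡ₚ y → u ≡ₚ v → x ℤ.+ u ≡ₚ y ℤ.+ v
  +-congₚ {x} {y} {u} {v} x≡y u≡v = difference⇒≡ₚ (x ℤ.+ u) (y ℤ.+ v) (difference x y u v) (ℤ.∣m∣n⇒∣m+n (p∣x-y x≡y) (p∣x-y u≡v))
    where
    difference : ∀ x y u v → (x ℤ.+ u) - (y ℤ.+ v) ≡ (x - y) ℤ.+ (u - v)
    difference = solve-∀

  *-congₚ : ∀ {x y u v} → x ≡ₚ y → u ≡ₚ v → x ℤ.* u ≡ₚ y ℤ.* v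
  *-congₚ {x} {y} {u} {v} x≡y u≡v = difference⇒≡ₚ (x ℤ.* u) (y ℤ.* v) (difference x y u v)
    (ℤ.∣m∣n⇒∣m+n (ℤ.∣m⇒∣m*n u (p∣x-y x≡y)) (ℤ.∣n⇒∣m*n y (p∣x-y u≡v)))
    where
    difference : ∀ x y u v → (x ℤ.* u) - (y ℤ.* v) ≡ (x - y) ℤ.* u ℤ.+ y ℤ.* (u - v)
    difference = solve-∀

  -‿congₚ : ∀ {x y} → x ≡ₚ y → ℤ.- x ≡ₚ ℤ.- y
  -‿congₚ {x} {y} x≡y = difference⇒≡ₚ (ℤ.- x) (ℤ.- y) (difference x y) (ℤ.∣m⇒∣-m (p∣x-y x≡y))
    where
    difference : ∀ x y → ℤ.- x - ℤ.- y ≡ ℤ.- (x - y)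
    difference = solve-∀

  ≡ₚ-isCommutativeRing : IsCommutativeRing _≡ₚ_ ℤ._+_ ℤ._*_ ℤ.-_ (+ 0) (+ 1)
  ≡ₚ-isCommutativeRing = record
    { isRing = record
      { +-isAbelianGroup = record
        { isGroup = record
          { isMonoid = record
            { isSemigroup = record
              { isMagma = record { isEquivalence = ≡ₚ-isEquivalence ; ∙-cong = +-congₚ }
              ; assoc   = λ x y z → ≡⇒≡ₚ (ℤ.+-assoc x y z) }
            ; identity  = (λ x → ≡⇒≡ₚ (ℤ.+-identityˡ x)) , (λ x → ≡⇒≡ₚ (ℤ.+-identityʳ x)) }
          ; inverse     = (λ x → ≡⇒≡ₚ (ℤ.+-inverseˡ x)) , (λ x → ≡⇒≡ₚ (ℤ.+-inverseʳ x))
          ; ⁻¹-cong     = -‿congₚ }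
        ; comm          = λ x y → ≡⇒≡ₚ (ℤ.+-comm x y) }
      ; *-cong          = *-congₚ
      ; *-assoc         = λ x y z → ≡⇒≡ₚ (ℤ.*-assoc x y z)
      ; *-identity      = (λ x → ≡⇒≡ₚ (ℤ.*-identityˡ x)) , (λ x → ≡⇒≡ₚ (ℤ.*-identityʳ x))
      ; distrib         = (λ x y z → ≡⇒≡ₚ (ℤ.*-distribˡ-+ x y z)) , (λ x y z → ≡⇒≡ₚ (ℤ.*-distribʳ-+ x y z)) }
    ; *-comm = λ x y → ≡⇒≡ₚ (ℤ.*-comm x y) }

  ℤ/pℤ : CommutativeRing 0ℓ 0ℓ
  ℤ/pℤ = record
    { Carrier = ℤ ; _≈_ = _≡ₚ_ ; _+_ = ℤ._+_ ; _*_ = ℤ._*_ ; -_ = ℤ.-_ ; 0# = + 0 ; 1# = + 1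
    ; isCommutativeRing = ≡ₚ-isCommutativeRing }

  p∣⇒≡ₚ0 : ∀ x → p ℕ.∣ ℤ.∣ x ∣ → x ≡ₚ + 0
  p∣⇒≡ₚ0 x p∣x = difference⇒≡ₚ x (+ 0) (ℤ.+-identityʳ x) (ℤ.∣ᵤ⇒∣ p∣x)

  1≢ₚ0 : ¬ (+ 1 ≡ₚ + 0)
  1≢ₚ0 1≡0 = ℕ.<⇒≱ (ℕ.nonTrivial⇒n>1 p ⦃ prime⇒nonTrivial p-prime ⦄) (ℕ.∣⇒≤ (ℤ.∣⇒∣ᵤ (p∣x-y 1≡0)))

  ℕ-Bézout⇒ℤ : ∀ {x y u v} → 1 ℕ.+ x ℕ.* y ≡ u ℕ.* v → + 1 ℤ.+ + x ℤ.* + y ≡ + u ℤ.* + v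
  ℕ-Bézout⇒ℤ {x} {y} {u} {v} e =
    ≡.trans (≡.cong (λ z → + 1 ℤ.+ z) (≡.sym (ℤ.pos-* x y))) (≡.trans (≡.sym (ℤ.pos-+ 1 (x ℕ.* y))) (≡.trans (≡.cong +_ e) (ℤ.pos-* u v)))

  p∣p*b : ∀ b → + p ℤ.∣ + b ℤ.* + p
  p∣p*b b = ℤ.∣n⇒∣m*n (+ b) ℤ.∣-refl

  inverse-ℕ : ∀ t → p ∤ t → Σ ℤ λ y → + t ℤ.* y ≡ₚ + 1
  inverse-ℕ t p∤t with coprime-Bézout (Coprimality.sym (prime∤⇒coprime p-prime p∤t))
  ... | Bézout.Identity.+- a b 1+bp≡at = + a , difference⇒≡ₚ (+ t ℤ.* + a) (+ 1) difference (p∣p*b b)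
    where
    difference : + t ℤ.* + a - + 1 ≡ + b ℤ.* + p
    difference = ≡.trans (≡.cong (_- + 1) (≡.trans (ℤ.*-comm (+ t) (+ a)) (≡.sym (ℕ-Bézout⇒ℤ {b} {p} {a} {t} 1+bp≡at)))) (cancel (+ b ℤ.* + p))
      where
      cancel : ∀ X → (+ 1 ℤ.+ X) - + 1 ≡ X
      cancel = solve-∀
  ... | Bézout.Identity.-+ a b 1+at≡bp = ℤ.- + a , difference⇒≡ₚ (+ t ℤ.* ℤ.- + a) (+ 1) difference (ℤ.∣m⇒∣-m (p∣p*b b))
    where
    difference : + t ℤ.* ℤ.- + a - + 1 ≡ ℤ.- (+ b ℤ.* + p)
    difference = ≡.trans (rearrange (+ t) (+ a)) (≡.cong ℤ.-_ (ℕ-Bézout⇒ℤ {a} {t} {b} {p} 1+at≡bp))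
      where
      rearrange : ∀ T A → T ℤ.* ℤ.- A - + 1 ≡ ℤ.- (+ 1 ℤ.+ A ℤ.* T)
      rearrange = solve-∀

  inverse : ∀ x → ¬ (x ≡ₚ + 0) → Σ ℤ λ y → x ℤ.* y ≡ₚ + 1
  inverse (+ t)    x≢0 = inverse-ℕ t (λ p∣t → x≢0 (p∣⇒≡ₚ0 (+ t) p∣t))
  inverse -[1+ t ] x≢0 with inverse-ℕ (suc t) (λ p∣t → x≢0 (p∣⇒≡ₚ0 -[1+ t ] p∣t))
  ... | y , [1+t]y≡1 = ℤ.- y , ≡.subst (_≡ₚ + 1) (neg*neg (+ suc t) y) [1+t]y≡1
    where
    neg*neg : ∀ x y → x ℤ.* y ≡ ℤ.- x ℤ.* ℤ.- y
    neg*neg = solve-∀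

  𝔽ₚ : Field
  𝔽ₚ = record { commRing = ℤ/pℤ ; 1≉0 = 1≢ₚ0 ; inverse = inverse }

  natK≡+ : ∀ n → natK 𝔽ₚ n ≡ + n
  natK≡+ zero    = ≡.refl
  natK≡+ (suc n) = ≡.cong (λ z → + 1 ℤ.+ z) (natK≡+ n)

  𝔽ₚ-char : HasChar 𝔽ₚ p
  𝔽ₚ-char = ≡.subst (_≡ₚ + 0) (≡.sym (natK≡+ p)) (p∣⇒≡ₚ0 (+ p) (ℕ.∣-refl))

  module _ {p′} (p≡1+2p′ : p ≡ suc (2 ℕ.* p′)) where

    open FieldTheory 𝔽ₚ
    open Characteristic 𝔽ₚ p-prime 𝔽ₚ-char
    open OddCharacteristic {p′} p≡1+2p′

    x^[2p′]≈1 : ∀ x → x ≉ 0# → x ^ (2 ℕ.* p′) ≈ 1#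
    x^[2p′]≈1 (+ t) x≉0 = ≡.subst (λ y → y ^ (2 ℕ.* p′) ≈ 1#) (natK≡+ t) (fermat-2p′ t (≡.subst (_≉ 0#) (≡.sym (natK≡+ t)) x≉0))
    x^[2p′]≈1 -[1+ t ] x≉0 = ≡.subst (λ y → (- y) ^ (2 ℕ.* p′) ≈ 1#) (natK≡+ (suc t)) (begin
      (- ι (suc t)) ^ (2 ℕ.* p′)                   ≈⟨ [-x]^n (ι (suc t)) (2 ℕ.* p′) ⟩
      (- 1#) ^ (2 ℕ.* p′) * ι (suc t) ^ (2 ℕ.* p′) ≈⟨ *-cong (-1^[2n]≈1 p′) (fermat-2p′ (suc t) ι[1+t]≉0) ⟩
      1# * 1#                                      ≈⟨ *-identityʳ 1# ⟩
      1#                                           ∎)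
      where
      ι[1+t]≉0 : ι (suc t) ≉ 0#
      ι[1+t]≉0 ι≈0 = x≉0 (≡.subst (λ y → - y ≈ 0#) (natK≡+ (suc t)) (-‿cong ι≈0 ⟨ trans ⟩ -0#≈0#))

    nonsquare : ∀ {β} → β ^ p′ ≈ - 1# → ∀ x → ¬ (x * x ≈ β)
    nonsquare {β} βᵖ′≈-1 x x²≈β = 1≉-1 (begin
      1#                  ≈⟨ x^[2p′]≈1 x x≉0 ⟨
      x ^ (2 ℕ.* p′)      ≈⟨ [x*x]^n≈x^[2n] x p′ ⟨
      (x * x) ^ p′        ≈⟨ ^-congˡ p′ x²≈β ⟩
      β ^ p′              ≈⟨ βᵖ′≈-1 ⟩
      - 1#                ∎)
      where
      x≉0 : x ≉ 0#
      x≉0 x≈0 = x^n≈-1⇒x≉0 p′ 1≉-1 βᵖ′≈-1 (sym x²≈β ⟨ trans ⟩ *-congʳ x≈0 ⟨ trans ⟩ zeroˡ x)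

module QuadraticExtension (F : Field) (β : Field.Carrier F) (β-nonsquare : ∀ x → ¬ Field._≈_ F (Field._*_ F x x) β) where

  open import Data.Integer using (+_)
  open import Data.Product using (Σ; _×_; _,_; proj₁; proj₂)
  open import Function.Base using (_⟨_⟩_)
  open import Relation.Binary.Structures using (IsEquivalence)
  open import Algebra.Structures using (IsCommutativeRing)
  open FieldTheory F

  -- F[√β] = F × F, the pair (u , v) standing for u + v√β
  infix 4 _≈ᴱ_
  _≈ᴱ_ : Carrier × Carrier → Carrier × Carrier → Set
  (u , v) ≈ᴱ (u′ , v′) = u ≈ u′ × v ≈ v′

  _+ᴱ_ _*ᴱ_ : Carrier × Carrier → Carrier × Carrier → Carrier × Carrier
  (u , v) +ᴱ (u′ , v′) = u + u′ , v + v′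
  (u , v) *ᴱ (u′ , v′) = u * u′ + β * (v * v′) , u * v′ + v * u′

  -ᴱ_ : Carrier × Carrier → Carrier × Carrier
  -ᴱ (u , v) = - u , - v

  0ᴱ 1ᴱ : Carrier × Carrier
  0ᴱ = 0# , 0#
  1ᴱ = 1# , 0#

  ≈ᴱ-isEquivalence : IsEquivalence _≈ᴱ_
  ≈ᴱ-isEquivalence = record
    { refl  = refl , refl
    ; sym   = λ (u≈ , v≈) → sym u≈ , sym v≈
    ; trans = λ (u≈ , v≈) (u≈′ , v≈′) → trans u≈ u≈′ , trans v≈ v≈′
    }

  isCommutativeRingᴱ : IsCommutativeRing _≈ᴱ_ _+ᴱ_ _*ᴱ_ -ᴱ_ 0ᴱ 1ᴱ
  isCommutativeRingᴱ = record
    { isRing = record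
      { +-isAbelianGroup = record
        { isGroup = record
          { isMonoid = record
            { isSemigroup = record
              { isMagma = record { isEquivalence = ≈ᴱ-isEquivalence ; ∙-cong = λ (e₁ , e₂) (f₁ , f₂) → +-cong e₁ f₁ , +-cong e₂ f₂ }
              ; assoc = λ _ _ _ → +-assoc _ _ _ , +-assoc _ _ _ }
            ; identity = (λ _ → +-identityˡ _ , +-identityˡ _) , (λ _ → +-identityʳ _ , +-identityʳ _) }
          ; inverse = (λ _ → -‿inverseˡ _ , -‿inverseˡ _) , (λ _ → -‿inverseʳ _ , -‿inverseʳ _)
          ; ⁻¹-cong = λ (e₁ , e₂) → -‿cong e₁ , -‿cong e₂ }
        ; comm = λ _ _ → +-comm _ _ , +-comm _ _ }
      ; *-cong = λ (e₁ , e₂) (f₁ , f₂) → +-cong (*-cong e₁ f₁) (*-congˡ (*-cong e₂ f₂)) , +-cong (*-cong e₁ f₂) (*-cong e₂ f₁)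
      ; *-assoc = λ (a , b) (c , d) (e , f) →
            solve 7 (λ a b c d e f β → ((a :* c :+ β :* (b :* d)) :* e :+ β :* ((a :* d :+ b :* c) :* f)) := (a :* (c :* e :+ β :* (d :* f)) :+ β :* (b :* (c :* f :+ d :* e)))) refl a b c d e f β
          , solve 7 (λ a b c d e f β → ((a :* c :+ β :* (b :* d)) :* f :+ (a :* d :+ b :* c) :* e) := (a :* (c :* f :+ d :* e) :+ b :* (c :* e :+ β :* (d :* f)))) refl a b c d e f β
      ; *-identity =
            (λ (a , b) → solve 3 (λ a b β → con (+ 1) :* a :+ β :* (con (+ 0) :* b) := a) refl a b β
                       , solve 2 (λ a b → con (+ 1) :* b :+ con (+ 0) :* a := b) refl a b)
          , (λ (a , b) → solve 3 (λ a b β → a :* con (+ 1) :+ β :* (b :* con (+ 0)) := a) refl a b β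
                       , solve 2 (λ a b → a :* con (+ 0) :+ b :* con (+ 1) := b) refl a b)
      ; distrib =
            (λ (a , b) (c , d) (e , f) →
                solve 7 (λ a b c d e f β → a :* (c :+ e) :+ β :* (b :* (d :+ f)) := (a :* c :+ β :* (b :* d)) :+ (a :* e :+ β :* (b :* f))) refl a b c d e f β
              , solve 6 (λ a b c d e f → a :* (d :+ f) :+ b :* (c :+ e) := (a :* d :+ b :* c) :+ (a :* f :+ b :* e)) refl a b c d e f)
          , (λ (a , b) (c , d) (e , f) →
                solve 7 (λ a b c d e f β → (c :+ e) :* a :+ β :* ((d :+ f) :* b) := (c :* a :+ β :* (d :* b)) :+ (e :* a :+ β :* (f :* b))) refl a b c d e f β
              , solve 6 (λ a b c d e f → (c :+ e) :* b :+ (d :+ f) :* a := (c :* b :+ d :* a) :+ (e :* b :+ f :* a)) refl a b c d e f) }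
    ; *-comm = λ (a , b) (c , d) →
          solve 5 (λ a b c d β → a :* c :+ β :* (b :* d) := c :* a :+ β :* (d :* b)) refl a b c d β
        , solve 4 (λ a b c d → a :* d :+ b :* c := c :* b :+ d :* a) refl a b c d }

  norm≉0 : ∀ u v → ¬ (u ≈ 0# × v ≈ 0#) → u * u - β * (v * v) ≉ 0#
  norm≉0 u v uv≉0 norm≈0 = ¬v≉0 (λ v≈0 → ¬u≉0 v≈0 (λ u≈0 → uv≉0 (u≈0 , v≈0)))
    where
    u²≈βv² : u * u ≈ β * (v * v)
    u²≈βv² = x∙y⁻¹≈ε⇒x≈y _ _ norm≈0
    ¬v≉0 : ¬ (v ≉ 0#)
    ¬v≉0 v≉0 = β-nonsquare (u * v⁻¹) (begin
      (u * v⁻¹) * (u * v⁻¹)        ≈⟨ solve 2 (λ u w → (u :* w) :* (u :* w) := (u :* u) :* (w :* w)) refl u v⁻¹ ⟩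
      (u * u) * (v⁻¹ * v⁻¹)        ≈⟨ *-congʳ u²≈βv² ⟩
      (β * (v * v)) * (v⁻¹ * v⁻¹)  ≈⟨ solve 3 (λ β v w → (β :* (v :* v)) :* (w :* w) := β :* ((v :* w) :* (v :* w))) refl β v v⁻¹ ⟩
      β * ((v * v⁻¹) * (v * v⁻¹))  ≈⟨ *-congˡ (*-cong (x*x⁻¹≈1 v v≉0) (x*x⁻¹≈1 v v≉0) ⟨ trans ⟩ *-identityʳ 1#) ⟩
      β * 1#                       ≈⟨ *-identityʳ β ⟩
      β                            ∎)
      where
      v⁻¹ = x⁻¹ v v≉0
    ¬u≉0 : v ≈ 0# → ¬ (u ≉ 0#)
    ¬u≉0 v≈0 u≉0 = *-nonzero u≉0 u≉0 (u²≈βv² ⟨ trans ⟩ *-congˡ (*-congʳ v≈0 ⟨ trans ⟩ zeroˡ v) ⟨ trans ⟩ zeroʳ β)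

  inverseᴱ : ∀ x → ¬ (x ≈ᴱ 0ᴱ) → Σ (Carrier × Carrier) λ y → x *ᴱ y ≈ᴱ 1ᴱ
  inverseᴱ (u , v) x≉0 = (u * norm⁻¹ , - v * norm⁻¹) , real-part , √β-part
    where
    norm≉0′ = norm≉0 u v x≉0
    norm⁻¹ = x⁻¹ (u * u - β * (v * v)) norm≉0′
    real-part : u * (u * norm⁻¹) + β * (v * (- v * norm⁻¹)) ≈ 1#
    real-part = solve 4 (λ u v β d → u :* (u :* d) :+ β :* (v :* ((:- v) :* d)) := (u :* u :- β :* (v :* v)) :* d) refl u v β norm⁻¹
                ⟨ trans ⟩ x*x⁻¹≈1 _ norm≉0′
    √β-part : u * (- v * norm⁻¹) + v * (u * norm⁻¹) ≈ 0#
    √β-part = solve 3 (λ u v d → u :* ((:- v) :* d) :+ v :* (u :* d) := con (+ 0)) refl u v norm⁻¹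

  F[√β] : Field
  F[√β] = record
    { commRing = record { isCommutativeRing = isCommutativeRingᴱ }
    ; 1≉0      = λ (1≈0 , _) → 1≉0 1≈0
    ; inverse  = inverseᴱ
    }

  module L = FieldTheory F[√β]

  embed : Carrier → Carrier × Carrier
  embed x = x , 0#

  √β : Carrier × Carrier
  √β = 0# , 1#

  √β*√β≈β : √β *ᴱ √β ≈ᴱ embed β
  √β*√β≈β = (+-cong (zeroˡ 0#) (*-congˡ (*-identityˡ 1#) ⟨ trans ⟩ *-identityʳ β) ⟨ trans ⟩ +-identityˡ β)
          , (+-cong (zeroˡ 1#) (zeroʳ 1#) ⟨ trans ⟩ +-identityʳ 0#)

  embed-cong : ∀ {x y} → x ≈ y → embed x ≈ᴱ embed y
  embed-cong x≈y = x≈y , refl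

  embed-* : ∀ x y → embed (x * y) ≈ᴱ embed x *ᴱ embed y
  embed-* x y = sym (+-congˡ (*-congˡ (zeroˡ 0#) ⟨ trans ⟩ zeroʳ β) ⟨ trans ⟩ +-identityʳ _)
              , sym (+-cong (zeroʳ x) (zeroˡ y) ⟨ trans ⟩ +-identityʳ 0#)

  embed-^ : ∀ x n → embed (x ^ n) ≈ᴱ embed x L.^ n
  embed-^ x zero    = refl , refl
  embed-^ x (suc n) = L.trans (embed-* x (x ^ n)) (L.*-congˡ (embed-^ x n))

  embed--1 : embed (- 1#) ≈ᴱ -ᴱ 1ᴱ
  embed--1 = refl , sym -0#≈0#

  embed-[-1]^ : ∀ n → embed ((- 1#) ^ n) ≈ᴱ (-ᴱ 1ᴱ) L.^ n
  embed-[-1]^ n = L.trans (embed-^ (- 1#) n) (L.^-congˡ n embed--1)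

  embed-ι : ∀ n → embed (ι n) ≈ᴱ L.ι n
  embed-ι zero    = refl , refl
  embed-ι (suc n) = +-congˡ (proj₁ (embed-ι n)) , sym (+-congˡ (proj₂ (L.sym (embed-ι n))) ⟨ trans ⟩ +-identityʳ 0#)

module Congruences where

  open import Data.Nat
  open import Data.Nat.Properties
  open import Data.Nat.DivMod
  open import Data.Nat.Divisibility using (_∣_; m%n≡0⇒n∣m; ∣-refl; ∣m∣n⇒∣m+n; ∣n⇒∣m*n)
  open import Data.Nat.GCD using (module Bézout)
  open import Data.Nat.Coprimality as Coprimality using (Coprime; coprime-Bézout; 0-coprimeTo-m⇒m≡1)
  open import Data.Nat.Primality using (Prime; prime⇒irreducible)
  open import Data.Nat.Tactic.RingSolver using (solve-∀)
  open import Data.Product using (Σ; _×_; _,_)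
  open import Data.Sum using (_⊎_; inj₁; inj₂)
  open import Data.Empty using (⊥-elim)
  open import Relation.Binary.PropositionalEquality
  open import Relation.Nullary using (Dec; yes; no; does)
  open import Relation.Nullary.Decidable using (_×-dec_; _⊎-dec_)
  open import Function.Bundles using (_⇔_; mk⇔)

  odd-prime≡1+2p′ : ∀ {p} → Prime p → p ≢ 2 → p ≡ suc (2 * ((p ∸ 1) / 2))
  odd-prime≡1+2p′ {p} p-prime p≢2 with p % 2 in p%2≡r | m%n<n p 2
  ... | 0 | _ with prime⇒irreducible p-prime (m%n≡0⇒n∣m p 2 p%2≡r)
  ...   | inj₁ ()
  ...   | inj₂ 2≡p = ⊥-elim (p≢2 (sym 2≡p))
  odd-prime≡1+2p′ {p} p-prime p≢2 | 1 | _ =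
    trans p≡1+[p/2]*2 (cong suc (trans (*-comm (p / 2) 2) (cong (2 *_) (sym [p∸1]/2≡p/2))))
    where
    p≡1+[p/2]*2 : p ≡ suc (p / 2 * 2)
    p≡1+[p/2]*2 = trans (m≡m%n+[m/n]*n p 2) (cong (_+ p / 2 * 2) p%2≡r)
    [p∸1]/2≡p/2 : (p ∸ 1) / 2 ≡ p / 2
    [p∸1]/2≡p/2 = trans (cong (λ x → (x ∸ 1) / 2) p≡1+[p/2]*2) (m*n/n≡m (p / 2) 2)
  odd-prime≡1+2p′ p-prime p≢2 | suc (suc _) | s≤s (s≤s ())

  even-remainder : ∀ {g k j p′} → 2 * g + 2 ≡ k * (2 * p′) + j → Σ ℕ λ j′ → j ≡ 2 * j′ × suc g ≡ k * p′ + j′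
  even-remainder {g} {k} {j} {p′} 2g+2≡2kp′+j = j / 2 , j≡2[j/2] , *-cancelˡ-≡ (suc g) (k * p′ + j / 2) 2 (begin
      2 * suc g                  ≡⟨ double-suc g ⟩
      2 * g + 2                  ≡⟨ 2g+2≡2kp′+j ⟩
      k * (2 * p′) + j           ≡⟨ cong (k * (2 * p′) +_) j≡2[j/2] ⟩
      k * (2 * p′) + 2 * (j / 2) ≡⟨ factor k p′ (j / 2) ⟩
      2 * (k * p′ + j / 2)       ∎)
    where
    open ≡-Reasoning
    double-suc : ∀ g → 2 * suc g ≡ 2 * g + 2
    double-suc = solve-∀
    factor : ∀ k p′ i → k * (2 * p′) + 2 * i ≡ 2 * (k * p′ + i)
    factor = solve-∀
    j%2≡0 : j % 2 ≡ 0
    j%2≡0 = begin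
      j % 2                   ≡⟨ [m+kn]%n≡m%n j (k * p′) 2 ⟨
      (j + k * p′ * 2) % 2    ≡⟨ cong (_% 2) (trans (swap j k p′) (trans (sym 2g+2≡2kp′+j) (double g))) ⟩
      (0 + suc g * 2) % 2     ≡⟨ [m+kn]%n≡m%n 0 (suc g) 2 ⟩
      0                       ∎
      where
      swap : ∀ j k p′ → j + k * p′ * 2 ≡ k * (2 * p′) + j
      swap = solve-∀
      double : ∀ g → 2 * g + 2 ≡ 0 + suc g * 2
      double = solve-∀
    j≡2[j/2] : j ≡ 2 * (j / 2)
    j≡2[j/2] = trans (m≡m%n+[m/n]*n j 2) (trans (cong (_+ j / 2 * 2) j%2≡0) (*-comm (j / 2) 2))

  2g+2≡m+2p′ : ∀ {g p p′} → p ≡ suc (2 * p′) → p ≤ 2 * g + 3 → 2 * g + 2 ≡ (2 * g + 3 ∸ p) + 2 * p′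
  2g+2≡m+2p′ {g} {p} {p′} p≡1+2p′ p≤2g+3 = suc-injective (begin
    suc (2 * g + 2)              ≡⟨ +-suc (2 * g) 2 ⟨
    2 * g + 3                    ≡⟨ m∸n+n≡m p≤2g+3 ⟨
    (2 * g + 3 ∸ p) + p          ≡⟨ cong ((2 * g + 3 ∸ p) +_) p≡1+2p′ ⟩
    (2 * g + 3 ∸ p) + suc (2 * p′) ≡⟨ +-suc _ (2 * p′) ⟩
    suc ((2 * g + 3 ∸ p) + 2 * p′) ∎)
    where open ≡-Reasoning

  coprime⇒1≤m : ∀ {g p p′} → 1 ≤ g → p ≡ suc (2 * p′) → p ≤ 2 * g + 3 → Coprime (g + 1) p′ → 1 ≤ 2 * g + 3 ∸ p
  coprime⇒1≤m {g} {p} {p′} 1≤g p≡1+2p′ p≤2g+3 g+1⊥p′ with m≤n⇒m<n∨m≡n p≤2g+3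
  ... | inj₁ p<2g+3 = m<n⇒0<n∸m p<2g+3
  ... | inj₂ p≡2g+3 = ⊥-elim (<⇒≢ (s≤s 1≤g) (sym (trans (+-comm 1 g) (g+1⊥p′ (∣-refl , subst (g + 1 ∣_) (sym p′≡g+1) ∣-refl)))))
    where
    p′≡g+1 : p′ ≡ g + 1
    p′≡g+1 = *-cancelˡ-≡ p′ (g + 1) 2 (suc-injective (trans (sym p≡1+2p′) (trans p≡2g+3 (odd g))))
      where
      odd : ∀ g → 2 * g + 3 ≡ suc (2 * (g + 1))
      odd = solve-∀

  coprime-remainder : ∀ {g k j′ p′} → Coprime (g + 1) p′ → suc g ≡ k * p′ + j′ → Coprime j′ p′
  coprime-remainder {g} {k} {j′} {p′} g+1⊥p′ 1+g≡kp′+j′ {d} (d∣j′ , d∣p′) =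
    g+1⊥p′ (subst (d ∣_) (trans (sym 1+g≡kp′+j′) (+-comm 1 g)) (∣m∣n⇒∣m+n (∣n⇒∣m*n k d∣p′) d∣j′) , d∣p′)

  inverse-mod : ∀ {j p′} → Coprime j p′ → p′ ≡ 1 ⊎ Σ ℕ (λ u → Σ ℕ (λ t → u * j ≡ suc (t * p′)))
  inverse-mod {j} {0} j⊥0 = inj₂ (1 , 0 , trans (*-identityˡ j) (0-coprimeTo-m⇒m≡1 (Coprimality.sym j⊥0)))
  inverse-mod {j} {1} _ = inj₁ refl
  inverse-mod {j} {p′@(suc (suc q))} j⊥p′ with coprime-Bézout j⊥p′
  ... | Bézout.Identity.+- u t 1+tp′≡uj = inj₂ (u , t , sym 1+tp′≡uj)
  ... | Bézout.Identity.-+ u zero 1+uj≡0 = ⊥-elim (1+n≢0 (trans 1+uj≡0 (*-zeroˡ p′)))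
  -- from u j ≡ -1 (mod p′): (u (p′-1)) j ≡ 1 (mod p′)
  ... | Bézout.Identity.-+ u (suc t) 1+uj≡[1+t]p′ = inj₂ (u * suc q , t * suc q + q , +-cancelˡ-≡ (suc q) _ _ (begin
    suc q + u * suc q * j             ≡⟨ expand₁ q u j ⟩
    suc q * (1 + u * j)               ≡⟨ cong (suc q *_) 1+uj≡[1+t]p′ ⟩
    suc q * (suc t * suc (suc q))     ≡⟨ expand₂ q t ⟩
    suc q + suc ((t * suc q + q) * suc (suc q)) ∎))
    where
    open ≡-Reasoning
    expand₁ : ∀ q u j → suc q + u * suc q * j ≡ suc q * (1 + u * j)
    expand₁ = solve-∀
    expand₂ : ∀ q t → suc q * (suc t * suc (suc q)) ≡ suc q + suc ((t * suc q + q) * suc (suc q))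
    expand₂ = solve-∀

  p′≡1+q₀ : ∀ {p p′} → 1 < p → p ≡ suc (2 * p′) → p′ ≡ suc (pred p′)
  p′≡1+q₀ {p′ = suc _} _ _ = refl
  p′≡1+q₀ {p′ = zero} (s≤s ()) refl

  coprime-to-even⇒odd : ∀ {j p′} → Coprime j p′ → p′ % 2 ≡ 0 → j % 2 ≡ 1
  coprime-to-even⇒odd {j} {p′} j⊥p′ p′%2≡0 with j % 2 in j%2≡r | m%n<n j 2
  ... | 0           | _ = ⊥-elim (2≢1 (j⊥p′ (m%n≡0⇒n∣m j 2 j%2≡r , m%n≡0⇒n∣m p′ 2 p′%2≡0)))
    where
    2≢1 : 2 ≢ 1
    2≢1 ()
  ... | 1           | _ = refl
  ... | suc (suc _) | s≤s (s≤s ())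

  -- conditions (i)-(iii), in terms of p mod 8, j mod 4, 2k mod 4 and (2k+2) mod 4
  Cases : ℕ → ℕ → ℕ → ℕ → Set
  Cases a b c d = (a ≡ 3 × b ≡ c) ⊎ (a ≡ 7 × b ≡ d) ⊎ (a ≡ 5 × b ≡ 2)

  ⌊n+2m/2⌋≡⌊n/2⌋+m : ∀ n m → ⌊ n + m * 2 /2⌋ ≡ ⌊ n /2⌋ + m
  ⌊n+2m/2⌋≡⌊n/2⌋+m n zero    = trans (cong ⌊_/2⌋ (+-identityʳ n)) (sym (+-identityʳ _))
  ⌊n+2m/2⌋≡⌊n/2⌋+m n (suc m) = begin
    ⌊ n + suc m * 2 /2⌋         ≡⟨ cong ⌊_/2⌋ (trans (+-suc n (suc (m * 2))) (cong suc (+-suc n (m * 2)))) ⟩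
    suc ⌊ n + m * 2 /2⌋         ≡⟨ cong suc (⌊n+2m/2⌋≡⌊n/2⌋+m n m) ⟩
    suc (⌊ n /2⌋ + m)           ≡⟨ +-suc ⌊ n /2⌋ m ⟨
    ⌊ n /2⌋ + suc m             ∎
    where open ≡-Reasoning

  [r+qd]%d≡r : ∀ r q d .⦃ _ : NonZero d ⦄ → r < d → (r + q * d) % d ≡ r
  [r+qd]%d≡r r q d r<d = trans ([m+kn]%n≡m%n r q d) (m<n⇒m%n≡m r<d)

  Dec⇔ : ∀ {P Q : Set} (P? : Dec P) (Q? : Dec Q) → does P? ≡ does Q? → P ⇔ Q
  Dec⇔ (yes p) (yes q) _  = mk⇔ (λ _ → q) (λ _ → p)
  Dec⇔ (no ¬p) (no ¬q) _  = mk⇔ (λ p → ⊥-elim (¬p p)) (λ q → ⊥-elim (¬q q))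
  Dec⇔ (yes _) (no _)  ()
  Dec⇔ (no _)  (yes _) ()

  cases? : ∀ a b c d → Dec (Cases a b c d)
  cases? a b c d = ((a ≟ 3) ×-dec (b ≟ c)) ⊎-dec ((a ≟ 7) ×-dec (b ≟ d)) ⊎-dec ((a ≟ 5) ×-dec (b ≟ 2))

  -- The condition in residues: s = p′ mod 4, κ = k mod 2, ι = j′ mod 2.
  residue-table : ∀ s κ ι → s < 4 → κ < 2 → ι < 2 → (s % 2 ≡ 0 → ι ≡ 1)
                → (⌈ s /2⌉ + κ * s + ι) % 2 ≡ s % 2 ⇔ Cases (suc (2 * s)) (2 * ι) (2 * κ) ((2 * κ + 2) % 4)
  residue-table s κ ι s<4 κ<2 ι<2 s-even⇒ι≡1 = Dec⇔ (_ ≟ _) (cases? _ _ _ _) (agree s κ ι s<4 κ<2 ι<2 s-even⇒ι≡1)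
    where
    agree : ∀ s κ ι → s < 4 → κ < 2 → ι < 2 → (s % 2 ≡ 0 → ι ≡ 1)
          → does ((⌈ s /2⌉ + κ * s + ι) % 2 ≟ s % 2) ≡ does (cases? (suc (2 * s)) (2 * ι) (2 * κ) ((2 * κ + 2) % 4))
    agree 0 κ 0 _ _ _ h = ⊥-elim (0≢1+n (h refl))
    agree 0 0 1 _ _ _ _ = refl
    agree 0 1 1 _ _ _ _ = refl
    agree 1 0 0 _ _ _ _ = refl
    agree 1 0 1 _ _ _ _ = refl
    agree 1 1 0 _ _ _ _ = refl
    agree 1 1 1 _ _ _ _ = refl
    agree 2 κ 0 _ _ _ h = ⊥-elim (0≢1+n (h refl))
    agree 2 0 1 _ _ _ _ = refl
    agree 2 1 1 _ _ _ _ = refl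
    agree 3 0 0 _ _ _ _ = refl
    agree 3 0 1 _ _ _ _ = refl
    agree 3 1 0 _ _ _ _ = refl
    agree 3 1 1 _ _ _ _ = refl
    agree (suc (suc (suc (suc _)))) _ _ (s≤s (s≤s (s≤s (s≤s ())))) _ _ _
    agree _ (suc (suc _)) _ _ (s≤s (s≤s ())) _ _
    agree _ _ (suc (suc _)) _ _ (s≤s (s≤s ())) _

  1+2x<2n : ∀ {x n} → x < n → suc (2 * x) < 2 * n
  1+2x<2n {x} {n} x<n = subst (_≤ 2 * n) (double-suc x) (*-monoʳ-≤ 2 x<n)
    where
    double-suc : ∀ x → 2 * suc x ≡ suc (suc (2 * x))
    double-suc = solve-∀

  Cases-cong : ∀ {a a′ b b′ c c′ d d′} → a ≡ a′ → b ≡ b′ → c ≡ c′ → d ≡ d′ → Cases a b c d ≡ Cases a′ b′ c′ d′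
  Cases-cong refl refl refl refl = refl

  [1+2x]%8≡1+2[x%4] : ∀ x → suc (2 * x) % 8 ≡ suc (2 * (x % 4))
  [1+2x]%8≡1+2[x%4] x = begin
    suc (2 * x) % 8                             ≡⟨ cong (λ y → suc (2 * y) % 8) (m≡m%n+[m/n]*n x 4) ⟩
    suc (2 * (x % 4 + x / 4 * 4)) % 8           ≡⟨ cong (_% 8) (regroup (x % 4) (x / 4)) ⟩
    (suc (2 * (x % 4)) + x / 4 * 8) % 8         ≡⟨ [r+qd]%d≡r (suc (2 * (x % 4))) (x / 4) 8 (1+2x<2n (m%n<n x 4)) ⟩
    suc (2 * (x % 4))                           ∎
    where
    open ≡-Reasoning
    regroup : ∀ r q → suc (2 * (r + q * 4)) ≡ suc (2 * r) + q * 8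
    regroup = solve-∀

  [2x]%4≡2[x%2] : ∀ x → (2 * x) % 4 ≡ 2 * (x % 2)
  [2x]%4≡2[x%2] x = begin
    (2 * x) % 4                          ≡⟨ cong (λ y → (2 * y) % 4) (m≡m%n+[m/n]*n x 2) ⟩
    (2 * (x % 2 + x / 2 * 2)) % 4        ≡⟨ cong (_% 4) (regroup (x % 2) (x / 2)) ⟩
    (2 * (x % 2) + x / 2 * 4) % 4        ≡⟨ [r+qd]%d≡r (2 * (x % 2)) (x / 2) 4 (<-trans (n<1+n _) (1+2x<2n (m%n<n x 2))) ⟩
    2 * (x % 2)                          ∎
    where
    open ≡-Reasoning
    regroup : ∀ r q → 2 * (r + q * 2) ≡ 2 * r + q * 4
    regroup = solve-∀

  [2x+2]%4≡[2[x%2]+2]%4 : ∀ x → (2 * x + 2) % 4 ≡ (2 * (x % 2) + 2) % 4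
  [2x+2]%4≡[2[x%2]+2]%4 x = begin
    (2 * x + 2) % 4                      ≡⟨ cong (λ y → (2 * y + 2) % 4) (m≡m%n+[m/n]*n x 2) ⟩
    (2 * (x % 2 + x / 2 * 2) + 2) % 4    ≡⟨ cong (_% 4) (regroup (x % 2) (x / 2)) ⟩
    (2 * (x % 2) + 2 + x / 2 * 4) % 4    ≡⟨ [m+kn]%n≡m%n (2 * (x % 2) + 2) (x / 2) 4 ⟩
    (2 * (x % 2) + 2) % 4                ∎
    where
    open ≡-Reasoning
    regroup : ∀ r q → 2 * (r + q * 2) + 2 ≡ 2 * r + 2 + q * 4
    regroup = solve-∀

  x≡x%4+2[2[x/4]] : ∀ x → x ≡ x % 4 + x / 4 * 2 * 2
  x≡x%4+2[2[x/4]] x = trans (m≡m%n+[m/n]*n x 4) (cong (x % 4 +_) (regroup (x / 4)))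
    where
    regroup : ∀ q → q * 4 ≡ q * 2 * 2
    regroup = solve-∀

  x%2≡[x%4]%2 : ∀ x → x % 2 ≡ (x % 4) % 2
  x%2≡[x%4]%2 x = trans (cong (_% 2) (x≡x%4+2[2[x/4]] x)) ([m+kn]%n≡m%n (x % 4) (x / 4 * 2) 2)

  ⌈x/2⌉≡⌈[x%4]/2⌉+2[x/4] : ∀ x → ⌈ x /2⌉ ≡ ⌈ x % 4 /2⌉ + x / 4 * 2
  ⌈x/2⌉≡⌈[x%4]/2⌉+2[x/4] x = trans (cong (λ y → ⌊ suc y /2⌋) (x≡x%4+2[2[x/4]] x)) (⌊n+2m/2⌋≡⌊n/2⌋+m (suc (x % 4)) (x / 4 * 2))

  parity-residues : ∀ p′ k j′ → (⌈ p′ /2⌉ + k * p′ + j′) % 2 ≡ (⌈ p′ % 4 /2⌉ + (k % 2) * (p′ % 4) + j′ % 2) % 2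
  parity-residues p′ k j′ = begin
    (⌈ p′ /2⌉ + k * p′ + j′) % 2
      ≡⟨ cong (_% 2) (cong₂ _+_ (cong₂ _+_ (⌈x/2⌉≡⌈[x%4]/2⌉+2[x/4] p′) (cong₂ _*_ (m≡m%n+[m/n]*n k 2) (m≡m%n+[m/n]*n p′ 4))) (m≡m%n+[m/n]*n j′ 2)) ⟩
    (c + q * 2 + (κ + a * 2) * (s + q * 4) + (ι + b * 2)) % 2
      ≡⟨ cong (_% 2) (regroup c q κ a s ι b) ⟩
    (c + κ * s + ι + (q + κ * q * 2 + a * s + a * q * 4 + b) * 2) % 2
      ≡⟨ [m+kn]%n≡m%n (c + κ * s + ι) (q + κ * q * 2 + a * s + a * q * 4 + b) 2 ⟩
    (c + κ * s + ι) % 2 ∎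
    where
    open ≡-Reasoning
    c = ⌈ p′ % 4 /2⌉
    s = p′ % 4
    q = p′ / 4
    κ = k % 2
    a = k / 2
    ι = j′ % 2
    b = j′ / 2
    regroup : ∀ c q κ a s ι b → c + q * 2 + (κ + a * 2) * (s + q * 4) + (ι + b * 2) ≡ c + κ * s + ι + (q + κ * q * 2 + a * s + a * q * 4 + b) * 2
    regroup = solve-∀

  parity⇔cases : ∀ {p′ k j′} → (p′ % 2 ≡ 0 → j′ % 2 ≡ 1)
               → (⌈ p′ /2⌉ + k * p′ + j′) % 2 ≡ p′ % 2 ⇔ Cases (suc (2 * p′) % 8) ((2 * j′) % 4) ((2 * k) % 4) ((2 * k + 2) % 4)
  parity⇔cases {p′} {k} {j′} p′-even⇒j′-odd =
    subst₂ _⇔_ (sym (cong₂ _≡_ (parity-residues p′ k j′) (x%2≡[x%4]%2 p′)))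
               (sym (Cases-cong ([1+2x]%8≡1+2[x%4] p′) ([2x]%4≡2[x%2] j′) ([2x]%4≡2[x%2] k) ([2x+2]%4≡[2[x%2]+2]%4 k)))
      (residue-table (p′ % 4) (k % 2) (j′ % 2) (m%n<n p′ 4) (m%n<n k 2) (m%n<n j′ 2)
        (λ s%2≡0 → p′-even⇒j′-odd (trans (x%2≡[x%4]%2 p′) s%2≡0)))

  module IntegerCondition {p p′ q₀ g k j j′} (p-prime : Prime p) (p≡1+2p′ : p ≡ suc (2 * p′)) (p′≡1+q₀ : p′ ≡ suc q₀)
                          (j≡2j′ : j ≡ 2 * j′) (1+g≡kp′+j′ : suc g ≡ k * p′ + j′) where

    open import Data.Integer as ℤ using (ℤ; +_; _-_)
    import Data.Integer.Properties as ℤ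
    import Data.Integer.Divisibility as ℤᵘ
    import Data.Integer.Divisibility.Signed as ℤˢ
    import Data.Integer.Tactic.RingSolver as ℤ-Solver
    open import Data.Nat.Divisibility using (∣⇒≤)
    open import Data.Nat.Primality using (euclidsLemma)

    X T : ℕ
    X = (p * p ∸ 5) / 4 + (j * p) / 2
    T = p′ + 1 + 2 * j′

    Z : ℤ
    Z = + k - + T

    X≡ : X ≡ (q₀ * q₀ + 3 * q₀ + 1) + j′ * p
    X≡ = cong₂ _+_ [p²-5]/4≡ [jp]/2≡
      where
      p≡ : p ≡ suc (2 * suc q₀)
      p≡ = trans p≡1+2p′ (cong (λ x → suc (2 * x)) p′≡1+q₀)
      square : ∀ q → suc (2 * suc q) * suc (2 * suc q) ≡ 5 + (q * q + 3 * q + 1) * 4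
      square = solve-∀
      [p²-5]/4≡ : (p * p ∸ 5) / 4 ≡ q₀ * q₀ + 3 * q₀ + 1
      [p²-5]/4≡ = trans (cong (λ x → (x * x ∸ 5) / 4) p≡)
                    (trans (cong (λ x → (x ∸ 5) / 4) (square q₀))
                      (trans (cong (_/ 4) (m+n∸m≡n 5 ((q₀ * q₀ + 3 * q₀ + 1) * 4))) (m*n/n≡m (q₀ * q₀ + 3 * q₀ + 1) 4)))
      commute : ∀ j p → 2 * j * p ≡ j * p * 2
      commute = solve-∀
      [jp]/2≡ : (j * p) / 2 ≡ j′ * p
      [jp]/2≡ = trans (cong (λ x → (x * p) / 2) j≡2j′) (trans (cong (_/ 2) (commute j′ p)) (m*n/n≡m (j′ * p) 2))

    g+p′T≡X+p′k : g + p′ * T ≡ X + p′ * k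
    g+p′T≡X+p′k = suc-injective (begin
      suc g + p′ * T                                        ≡⟨ cong (_+ p′ * T) 1+g≡kp′+j′ ⟩
      k * p′ + j′ + p′ * (p′ + 1 + 2 * j′)                  ≡⟨ cong (λ x → k * x + j′ + x * (x + 1 + 2 * j′)) p′≡1+q₀ ⟩
      k * suc q₀ + j′ + suc q₀ * (suc q₀ + 1 + 2 * j′)      ≡⟨ expand k q₀ j′ ⟩
      suc ((q₀ * q₀ + 3 * q₀ + 1) + j′ * suc (2 * suc q₀) + suc q₀ * k) ≡⟨ cong (λ x → suc ((q₀ * q₀ + 3 * q₀ + 1) + j′ * suc (2 * x) + x * k)) p′≡1+q₀ ⟨
      suc ((q₀ * q₀ + 3 * q₀ + 1) + j′ * suc (2 * p′) + p′ * k) ≡⟨ cong (λ x → suc ((q₀ * q₀ + 3 * q₀ + 1) + j′ * x + p′ * k)) p≡1+2p′ ⟨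
      suc ((q₀ * q₀ + 3 * q₀ + 1) + j′ * p + p′ * k)        ≡⟨ cong (λ x → suc (x + p′ * k)) X≡ ⟨
      suc (X + p′ * k)                                      ∎)
      where
      open ≡-Reasoning
      expand : ∀ k q j → k * suc q + j + suc q * (suc q + 1 + 2 * j) ≡ suc ((q * q + 3 * q + 1) + j * suc (2 * suc q) + suc q * k)
      expand = solve-∀

    n : ℕ
    n = 2 * g + 2

    1+2n+2k+p≡2kp+2T : suc (2 * n) + (2 * k + p) ≡ 2 * k * p + 2 * T
    1+2n+2k+p≡2kp+2T = begin
      suc (2 * (2 * g + 2)) + (2 * k + p)            ≡⟨ regroup g k p ⟩
      1 + 4 * suc g + (2 * k + p)                    ≡⟨ cong₂ (λ x y → 1 + 4 * x + (2 * k + y)) 1+g≡kp′+j′ p≡1+2p′ ⟩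
      1 + 4 * (k * p′ + j′) + (2 * k + suc (2 * p′)) ≡⟨ expand k p′ j′ ⟩
      2 * k * suc (2 * p′) + 2 * T                   ≡⟨ cong (λ x → 2 * k * x + 2 * T) p≡1+2p′ ⟨
      2 * k * p + 2 * T                              ∎
      where
      open ≡-Reasoning
      regroup : ∀ g k p → suc (2 * (2 * g + 2)) + (2 * k + p) ≡ 1 + 4 * suc g + (2 * k + p)
      regroup = solve-∀
      expand : ∀ k p′ j′ → 1 + 4 * (k * p′ + j′) + (2 * k + suc (2 * p′)) ≡ 2 * k * suc (2 * p′) + 2 * (p′ + 1 + 2 * j′)
      expand = solve-∀

    balanced⇒difference : ∀ a b c d → a + b ≡ c + d → + a - + c ≡ + d - + b
    balanced⇒difference a b c d a+b≡c+d = begin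
      + a - + c                     ≡⟨ add-sub (+ a) (+ b) (+ c) ⟩
      ((+ a ℤ.+ + b) - + c) - + b   ≡⟨ cong (λ x → (x - + c) - + b) (trans (sym (ℤ.pos-+ a b)) (trans (cong +_ a+b≡c+d) (ℤ.pos-+ c d))) ⟩
      ((+ c ℤ.+ + d) - + c) - + b   ≡⟨ cancel (+ c) (+ d) (+ b) ⟩
      + d - + b                     ∎
      where
      open ≡-Reasoning
      add-sub : ∀ A B C → A - C ≡ ((A ℤ.+ B) - C) - B
      add-sub = ℤ-Solver.solve-∀
      cancel : ∀ C D B → ((C ℤ.+ D) - C) - B ≡ D - B
      cancel = ℤ-Solver.solve-∀

    g-X≡p′Z : + g - + X ≡ + p′ ℤ.* Z
    g-X≡p′Z = begin
      + g - + X                      ≡⟨ balanced⇒difference g (p′ * T) X (p′ * k) g+p′T≡X+p′k ⟩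
      + (p′ * k) - + (p′ * T)        ≡⟨ cong₂ _-_ (ℤ.pos-* p′ k) (ℤ.pos-* p′ T) ⟩
      + p′ ℤ.* + k - + p′ ℤ.* + T    ≡⟨ factor (+ p′) (+ k) (+ T) ⟩
      + p′ ℤ.* Z                     ∎
      where
      open ≡-Reasoning
      factor : ∀ P K T → P ℤ.* K - P ℤ.* T ≡ P ℤ.* (K - T)
      factor = ℤ-Solver.solve-∀

    1+2n≡p[2k-1]-2Z : + suc (2 * n) ≡ + p ℤ.* (+ 2 ℤ.* + k - + 1) - + 2 ℤ.* Z
    1+2n≡p[2k-1]-2Z = begin
      + suc (2 * n)                                          ≡⟨ isolate (+ suc (2 * n)) (+ (2 * k * p)) _ (balanced⇒difference (suc (2 * n)) (2 * k + p) (2 * k * p) (2 * T) 1+2n+2k+p≡2kp+2T) ⟩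
      + (2 * k * p) ℤ.+ (+ (2 * T) - + (2 * k + p))          ≡⟨ cong₂ (λ x y → x ℤ.+ (+ (2 * T) - y)) (trans (ℤ.pos-* (2 * k) p) (cong (ℤ._* + p) (ℤ.pos-* 2 k))) (ℤ.pos-+ (2 * k) p) ⟩
      + 2 ℤ.* + k ℤ.* + p ℤ.+ (+ (2 * T) - (+ (2 * k) ℤ.+ + p)) ≡⟨ cong₂ (λ x y → + 2 ℤ.* + k ℤ.* + p ℤ.+ (x - (y ℤ.+ + p))) (ℤ.pos-* 2 T) (ℤ.pos-* 2 k) ⟩
      + 2 ℤ.* + k ℤ.* + p ℤ.+ (+ 2 ℤ.* + T - (+ 2 ℤ.* + k ℤ.+ + p)) ≡⟨ rearrange (+ k) (+ p) (+ T) ⟩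
      + p ℤ.* (+ 2 ℤ.* + k - + 1) - + 2 ℤ.* Z                ∎
      where
      open ≡-Reasoning
      isolate : ∀ A C E → A - C ≡ E → A ≡ C ℤ.+ E
      isolate A C E A-C≡E = trans (add-back A C) (cong (λ x → C ℤ.+ x) A-C≡E)
        where
        add-back : ∀ A C → A ≡ C ℤ.+ (A - C)
        add-back = ℤ-Solver.solve-∀
      rearrange : ∀ K P T → + 2 ℤ.* K ℤ.* P ℤ.+ (+ 2 ℤ.* T - (+ 2 ℤ.* K ℤ.+ P)) ≡ P ℤ.* (+ 2 ℤ.* K - + 1) - + 2 ℤ.* (K - T)
      rearrange = ℤ-Solver.solve-∀

    condition⇔p∣1+2n : + (p * p′) ℤᵘ.∣ (+ g - + X) ⇔ p ∣ suc (2 * n)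
    condition⇔p∣1+2n = mk⇔
      (λ pp′∣g-X → ℤˢ.∣⇒∣ᵤ (p∣Z⇒p∣1+2n (pp′∣g-X⇒p∣Z (ℤˢ.∣ᵤ⇒∣ pp′∣g-X))))
      (λ p∣1+2n → ℤˢ.∣⇒∣ᵤ (p∣Z⇒pp′∣g-X (p∣1+2n⇒p∣Z (ℤˢ.∣ᵤ⇒∣ {+ p} {+ suc (2 * n)} p∣1+2n))))
      where
      pp′∣g-X⇒p∣Z : + (p * p′) ℤˢ.∣ (+ g - + X) → + p ℤˢ.∣ Z
      pp′∣g-X⇒p∣Z pp′∣g-X = cancel p′≡1+q₀ (subst₂ ℤˢ._∣_ (ℤ.pos-* p p′) (trans g-X≡p′Z (ℤ.*-comm (+ p′) Z)) pp′∣g-X)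
        where
        cancel : ∀ {r} → r ≡ suc q₀ → + p ℤ.* + r ℤˢ.∣ Z ℤ.* + r → + p ℤˢ.∣ Z
        cancel refl = ℤˢ.*-cancelʳ-∣ (+ suc q₀)
      p∣Z⇒pp′∣g-X : + p ℤˢ.∣ Z → + (p * p′) ℤˢ.∣ (+ g - + X)
      p∣Z⇒pp′∣g-X p∣Z = subst₂ ℤˢ._∣_ (sym (ℤ.pos-* p p′)) (sym (trans g-X≡p′Z (ℤ.*-comm (+ p′) Z))) (ℤˢ.*-monoˡ-∣ (+ p′) p∣Z)
      p∣Z⇒p∣1+2n : + p ℤˢ.∣ Z → + p ℤˢ.∣ + suc (2 * n)
      p∣Z⇒p∣1+2n p∣Z = subst (+ p ℤˢ.∣_) (sym 1+2n≡p[2k-1]-2Z) (ℤˢ.∣m∣n⇒∣m-n (ℤˢ.∣m⇒∣m*n _ ℤˢ.∣-refl) (ℤˢ.∣n⇒∣m*n (+ 2) p∣Z))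
      p∣1+2n⇒p∣Z : + p ℤˢ.∣ + suc (2 * n) → + p ℤˢ.∣ Z
      p∣1+2n⇒p∣Z p∣1+2n = p∤2 (euclidsLemma 2 ℤ.∣ Z ∣ p-prime (subst (p ∣_) (ℤ.abs-* (+ 2) Z) (ℤˢ.∣⇒∣ᵤ {+ p} {+ 2 ℤ.* Z} p∣2Z)))
        where
        p∣2Z : + p ℤˢ.∣ + 2 ℤ.* Z
        p∣2Z = subst (+ p ℤˢ.∣_)
                 (sym (isolate-2Z (+ suc (2 * n)) (+ p ℤ.* (+ 2 ℤ.* + k - + 1)) (+ 2 ℤ.* Z) 1+2n≡p[2k-1]-2Z))
                 (ℤˢ.∣m∣n⇒∣m-n (ℤˢ.∣m⇒∣m*n _ ℤˢ.∣-refl) p∣1+2n)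
          where
          isolate-2Z : ∀ W Q E → W ≡ Q - E → E ≡ Q - W
          isolate-2Z W Q E refl = flip Q E
            where
            flip : ∀ Q E → E ≡ Q - (Q - E)
            flip = ℤ-Solver.solve-∀
        2<p : 2 < p
        2<p = subst (2 <_) (sym (trans p≡1+2p′ (cong (λ x → suc (2 * x)) p′≡1+q₀))) (s≤s (s≤s (≤-trans (s≤s z≤n) (m≤n+m _ q₀))))
        p∤2 : p ∣ 2 ⊎ p ∣ ℤ.∣ Z ∣ → + p ℤˢ.∣ Z
        p∤2 (inj₁ p∣2)   = ⊥-elim (<⇒≱ 2<p (∣⇒≤ p∣2))
        p∤2 (inj₂ p∣∣Z∣) = ℤˢ.∣ᵤ⇒∣ {+ p} {Z} p∣∣Z∣

open import Data.Nat using (ℕ; _+_; _*_; _∸_; _/_; _%_; _≤_; _<_; suc; ⌈_/2⌉)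
open import Data.Nat.Primality using (Prime; prime⇒nonTrivial)
open import Data.Nat.GCD using (gcd)
open import Data.Integer using (+_; _-_)
open import Data.Integer.Divisibility using (_∣_)
open import Data.Product using (_×_)
open import Data.Sum using (_⊎_)
open import Function.Bundles using (_⇔_)
open import Function.Construct.Composition using (_⇔-∘_)
open import Function.Construct.Symmetry using (⇔-sym)
open import Relation.Binary.PropositionalEquality using (_≡_; _≢_)

module Setting {p g j k : ℕ} (p-prime : Prime p) (p≢2 : p ≢ 2) (1≤g : 1 ≤ g) (p≤2g+3 : p ≤ 2 * g + 3)
               (gcd≡1 : gcd (g + 1) ((p ∸ 1) / 2) ≡ 1) (2g+2≡k[p-1]+j : 2 * g + 2 ≡ k * (p ∸ 1) + j) where

  import Data.Nat.Properties as ℕ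
  import Data.Nat.Divisibility as ℕ
  open import Data.Nat.Coprimality using (Coprime; gcd≡1⇒coprime)
  open import Data.Nat.Tactic.RingSolver using (solve-∀)
  open import Data.Product using (Σ; _,_; proj₁; proj₂)
  open import Function.Bundles using (mk⇔)
  open import Data.Product.Function.NonDependent.Propositional using (_×-⇔_)
  open import Relation.Binary.PropositionalEquality using (refl; sym; trans; cong; subst)
  open Congruences

  p′ n m : ℕ
  p′ = (p ∸ 1) / 2
  n  = 2 * g + 2
  m  = 2 * g + 3 ∸ p

  p≡1+2p′ : p ≡ suc (2 * p′)
  p≡1+2p′ = odd-prime≡1+2p′ p-prime p≢2

  n≡2kp′+j : n ≡ k * (2 * p′) + j
  n≡2kp′+j = trans 2g+2≡k[p-1]+j (cong (λ x → k * x + j) (cong (_∸ 1) p≡1+2p′))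

  decomposition : Σ ℕ λ j′ → j ≡ 2 * j′ × suc g ≡ k * p′ + j′
  decomposition = even-remainder {g} {k} {j} {p′} n≡2kp′+j

  j′ : ℕ
  j′ = proj₁ decomposition

  j≡2j′ : j ≡ 2 * j′
  j≡2j′ = proj₁ (proj₂ decomposition)

  1+g≡kp′+j′ : suc g ≡ k * p′ + j′
  1+g≡kp′+j′ = proj₂ (proj₂ decomposition)

  n≡2kp′+2j′ : n ≡ k * (2 * p′) + 2 * j′
  n≡2kp′+2j′ = trans n≡2kp′+j (cong (λ x → k * (2 * p′) + x) j≡2j′)

  n≡2[g+1] : n ≡ 2 * (g + 1)
  n≡2[g+1] = double g
    where
    double : ∀ g → 2 * g + 2 ≡ 2 * (g + 1)
    double = solve-∀

  n≡m+2p′ : n ≡ m + 2 * p′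
  n≡m+2p′ = 2g+2≡m+2p′ {g} {p} {p′} p≡1+2p′ p≤2g+3

  g+1⊥p′ : Coprime (g + 1) p′
  g+1⊥p′ = gcd≡1⇒coprime gcd≡1

  1≤m : 1 ≤ m
  1≤m = coprime⇒1≤m {g} {p} {p′} 1≤g p≡1+2p′ p≤2g+3 g+1⊥p′

  j′⊥p′ : Coprime j′ p′
  j′⊥p′ = coprime-remainder {g} {k} {j′} {p′} g+1⊥p′ 1+g≡kp′+j′

  Parity : Set
  Parity = (⌈ p′ /2⌉ + k * p′ + j′) % 2 ≡ p′ % 2

  hasRepeatedRoot⇒ : HasRepeatedRoot p g → p ℕ.∣ suc (2 * n) × Parity
  hasRepeatedRoot⇒ (K , char-K , a , repeated) =
    p∣1+2n , parity {k} {j′} n≡2kp′+2j′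
    where
    f[a]≈0×af′[a]≈0 = Polynomial.repeatedRoot⇒ K p g repeated
    open TrinomialRoots K p-prime char-K {p′} p≡1+2p′ {m} {n} n≡m+2p′
    open DoubleRoot n≡2[g+1] g+1⊥p′ 1≤m (proj₁ f[a]≈0×af′[a]≈0) (proj₂ f[a]≈0×af′[a]≈0)

  ⇒hasRepeatedRoot : p ℕ.∣ suc (2 * n) × Parity → HasRepeatedRoot p g
  ⇒hasRepeatedRoot (p∣1+2n , parity) = F[√β] , char-L , √β , Polynomial.⇒repeatedRoot F[√β] p g √β≉0 f[√β]≈0 √βf′[√β]≈0
    where
    open PrimeField p-prime using (𝔽ₚ; 𝔽ₚ-char; nonsquare)
    module 𝔽ₚ = FieldTheory 𝔽ₚ
    open Admissibility 𝔽ₚ p-prime 𝔽ₚ-char {p′} p≡1+2p′ using (Admissible; admissible-exists)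
    admissible : Σ 𝔽ₚ.Carrier (Admissible k j′)
    admissible = admissible-exists {k} {j′} (𝔽ₚ.%2-cong⇒-1^≈ (⌈ p′ /2⌉ + k * p′ + j′) p′ parity) (inverse-mod j′⊥p′)
    β : 𝔽ₚ.Carrier
    β = proj₁ admissible
    open QuadraticExtension 𝔽ₚ β (nonsquare {p′} p≡1+2p′ (proj₁ (proj₂ admissible)))
    char-L : HasChar F[√β] p
    char-L = L.trans (L.sym (embed-ι p)) (embed-cong 𝔽ₚ-char)
    open TrinomialRoots F[√β] p-prime char-L {p′} p≡1+2p′ {m} {n} n≡m+2p′
    embed-admissible : Admissibility.Admissible F[√β] p-prime char-L {p′} p≡1+2p′ k j′ (embed β)
    embed-admissible = βᵖ′≈-1 , 2[-1]ᵏβʲ′≈-1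
      where
      βᵖ′≈-1 : embed β L.^ p′ L.≈ L.- L.1#
      βᵖ′≈-1 = L.trans (L.sym (embed-^ β p′)) (L.trans (embed-cong (proj₁ (proj₂ admissible))) embed--1)
      2[-1]ᵏβʲ′≈-1 : L.ι 2 L.* (L.- L.1#) L.^ k L.* embed β L.^ j′ L.≈ L.- L.1#
      2[-1]ᵏβʲ′≈-1 = L.trans (L.*-cong (L.*-cong (L.sym (embed-ι 2)) (L.sym (embed-[-1]^ k))) (L.sym (embed-^ β j′)))
                       (L.trans (L.sym (L.trans (embed-* (𝔽ₚ.ι 2 𝔽ₚ.* (𝔽ₚ.- 𝔽ₚ.1#) 𝔽ₚ.^ k) (β 𝔽ₚ.^ j′)) (L.*-congʳ (embed-* (𝔽ₚ.ι 2) ((𝔽ₚ.- 𝔽ₚ.1#) 𝔽ₚ.^ k)))))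
                         (L.trans (embed-cong (proj₂ (proj₂ admissible))) embed--1))
    root-conditions = square-of-admissible {k} {j′} n≡2kp′+2j′ embed-admissible √β*√β≈β
    double-root = ⇒doubleRoot (proj₁ root-conditions) (proj₂ root-conditions) p∣1+2n
    f[√β]≈0 = proj₁ double-root
    √βf′[√β]≈0 = proj₂ double-root
    √β≉0 : √β L.≉ L.0#
    √β≉0 (_ , 1≈0) = 𝔽ₚ.1≉0 1≈0

  hasRepeatedRoot⇔ : HasRepeatedRoot p g ⇔ (p ℕ.∣ suc (2 * n) × Parity)
  hasRepeatedRoot⇔ = mk⇔ hasRepeatedRoot⇒ ⇒hasRepeatedRoot

  condition⇔ : ((+ (p * p′) ∣ (+ g - + ((p * p ∸ 5) / 4 + (j * p) / 2)))
                × Cases (p % 8) (j % 4) ((2 * k) % 4) ((2 * k + 2) % 4))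
             ⇔ (p ℕ.∣ suc (2 * n) × Parity)
  condition⇔ = IntegerCondition.condition⇔p∣1+2n {p} {p′} {ℕ.pred p′} {g} {k} {j} {j′} p-prime p≡1+2p′ p′≡1+q₀′ j≡2j′ 1+g≡kp′+j′
               ×-⇔ ⇔-sym (subst (Parity ⇔_) (Cases-cong (cong (_% 8) (sym p≡1+2p′)) (cong (_% 4) (sym j≡2j′)) refl refl)
                                 (parity⇔cases {p′} {k} {j′} (coprime-to-even⇒odd j′⊥p′)))
    where
    p′≡1+q₀′ : p′ ≡ suc (ℕ.pred p′)
    p′≡1+q₀′ = p′≡1+q₀ (ℕ.nonTrivial⇒n>1 p ⦃ prime⇒nonTrivial p-prime ⦄) p≡1+2p′

theorem8 : (p g j k : ℕ) → Prime p → p ≢ 2 → 1 ≤ g → p ≤ 2 * g + 3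
    → gcd (g + 1) ((p ∸ 1) / 2) ≡ 1
    → 2 * g + 2 ≡ k * (p ∸ 1) + j → j < p ∸ 1
    → HasRepeatedRoot p g
      ⇔ ((+ (p * ((p ∸ 1) / 2)) ∣ (+ g - + ((p * p ∸ 5) / 4 + (j * p) / 2)))
         × ((p % 8 ≡ 3 × j % 4 ≡ (2 * k) % 4)
            ⊎ (p % 8 ≡ 7 × j % 4 ≡ (2 * k + 2) % 4)
            ⊎ (p % 8 ≡ 5 × j % 4 ≡ 2)))
theorem8 p g j k p-prime p≢2 1≤g p≤2g+3 gcd≡1 2g+2≡k[p-1]+j _ = ⇔-sym condition⇔ ⇔-∘ hasRepeatedRoot⇔
  where open Setting {p} {g} {j} {k} p-prime p≢2 1≤g p≤2g+3 gcd≡1 2g+2≡k[p-1]+j
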